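{- Let $F$ be a formula over pairwise disjoint sets of variables $X\cup Y\cup Z$ with $X=\{x_1,\ldots,x_n\}$, such that for every truth assignment to $X\cup Y$ the values of the variables in $Z$ are determined by unit propagation in $F$. Let $c_X(F)=\{\gamma\vee\neg a\vee\neg b : \gamma\in F\}\cup\{\neg x_i\vee v_i,\ x_i\vee v_i : 1\le i\le n\}\cup\{\neg v_1\vee\cdots\vee\neg v_n\vee a,\ \neg v_1\vee\cdots\vee\neg v_n\vee b\}$, with $a,b,v_1,\ldots,v_n$ new variables. With branching allowed only on the variables in $X\cup Y$, \[ s(c_X(F)) = 2^n-1+\sum_{X'} s(F|X'), \] where the sum ranges over all $2^n$ truth assignments $X'$ to the variables $X$.
   Context: A formula is a finite set of clauses; the empty clause is a contradiction. $F|I$ denotes $F$ simplified under the partial assignment $I$ (clauses with a true literal removed, false literals deleted); $Var(F)$ is its set of variables. A binary tree is $()$ or $(x~T_1~T_2)$; its size is its number of nodes. Let $U(F)$ be obtained from $F$ by exhaustively applying unit propagation. For a set $B$ of allowed branching variables, a DPLL-Mono search tree (DMST) of $F$ is $()$ if $U(F)$ contains the empty clause, and otherwise $(x~T_1~T_2)$ with $x\in Var(U(F))\cap B$ and $T_1,T_2$ DMSTs of $U(F)|\{\neg x\}$ and $U(F)|\{x\}$. $s(G)$ denotes the minimum size of a DMST of $G$ (with branching restricted to $X\cup Y$), and $s(G)=\infty$ if $G$ has none (e.g., is satisfiable). -}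

module Defs where

open import Data.Nat using (ℕ; zero; suc; _+_; _≤_; _≡ᵇ_)
open import Data.Bool using (Bool; true; false; not; _∧_; _∨_; if_then_else_)
open import Data.List using (List; []; _∷_; _++_; length; map; concat)
import Data.List as L
open import Data.List.Membership.Propositional using (_∈_)
open import Data.Vec using (Vec; []; _∷_; lookup)
open import Data.Fin using (Fin)
open import Data.Maybe using (Maybe; just; nothing)
open import Data.Product using (Σ; ∃; _×_; _,_; proj₁; proj₂)
open import Data.Sum using (_⊎_)
open import Relation.Nullary using (¬_)
open import Relation.Binary.PropositionalEquality using (_≡_)

data Lit : Set where
  pos : ℕ → Lit
  neg : ℕ → Lit

var : Lit → ℕ
var (pos x) = x
var (neg x) = x

compl : Lit → Lit
compl (pos x) = neg x
compl (neg x) = pos x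

lit : ℕ → Bool → Lit
lit x true  = pos x
lit x false = neg x

Clause : Set
Clause = List Lit

-- A formula is a finite set of clauses, represented as a list
-- (order and repetitions are irrelevant for everything below).
Formula : Set
Formula = List Clause

-- A partial assignment is a (consistent) list of literals made true.
PAssign : Set
PAssign = List Lit

litEq : Lit → Lit → Bool
litEq (pos x) (pos y) = x ≡ᵇ y
litEq (neg x) (neg y) = x ≡ᵇ y
litEq _ _ = false

memLit : Lit → List Lit → Bool
memLit l [] = false
memLit l (m ∷ ms) = litEq l m ∨ memLit l ms

satByI : PAssign → Clause → Bool
satByI I [] = false
satByI I (l ∷ C) = memLit l I ∨ satByI I C

shrink : PAssign → Clause → Clause
shrink I [] = []
shrink I (l ∷ C) = if memLit (compl l) I then shrink I C else l ∷ shrink I C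

_∣_ : Formula → PAssign → Formula
[] ∣ I = []
(C ∷ F) ∣ I = if satByI I C then F ∣ I else shrink I C ∷ (F ∣ I)

_∈Var_ : ℕ → Formula → Set
y ∈Var F = Σ Clause λ C → C ∈ F × (pos y ∈ C ⊎ neg y ∈ C)

findUnit : Formula → Maybe Lit
findUnit [] = nothing
findUnit ((l ∷ []) ∷ F) = just l
findUnit (_ ∷ F) = findUnit F

-- Each step removes at least the unit
-- clause, so fuel = length F suffices for exhaustive propagation.
upT : ℕ → Formula → List Lit × Formula
upT zero F = [] , F
upT (suc k) F with findUnit F
... | nothing = [] , F
... | just l  = let r = upT k (F ∣ (l ∷ [])) in (l ∷ proj₁ r) , proj₂ r

trail : Formula → List Lit
trail F = proj₁ (upT (length F) F)

U : Formula → Formula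
U F = proj₂ (upT (length F) F)

Conflict : Formula → Set
Conflict G = [] ∈ U G

data Tree : Set where
  leaf : Tree
  node : ℕ → Tree → Tree → Tree

size : Tree → ℕ
size leaf = 0
size (node x T₁ T₂) = suc (size T₁ + size T₂)

data DMST (B : ℕ → Set) : Formula → Tree → Set where
  dleaf : ∀ {G} → Conflict G → DMST B G leaf
  dnode : ∀ {G x T₁ T₂} → ¬ Conflict G → x ∈Var U G → B x →
          DMST B (U G ∣ (neg x ∷ [])) T₁ →
          DMST B (U G ∣ (pos x ∷ [])) T₂ →
          DMST B G (node x T₁ T₂)

data ℕ∞ : Set where
  fin : ℕ → ℕ∞
  ∞   : ℕ∞

_+∞_ : ℕ∞ → ℕ∞ → ℕ∞
fin m +∞ fin n = fin (m + n)
_ +∞ _ = ∞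

MinSize : (ℕ → Set) → Formula → ℕ∞ → Set
MinSize B G (fin k) =
  (Σ Tree λ T → DMST B G T × size T ≡ k) ×
  (∀ T → DMST B G T → k ≤ size T)
MinSize B G ∞ = ¬ (Σ Tree λ T → DMST B G T)

-- c_X(F) for X = {x 0, …, x (n-1)} and new variables a, b, v 0, …, v (n-1)
cX : (n : ℕ) → (Fin n → ℕ) → (Fin n → ℕ) → ℕ → ℕ → Formula → Formula
cX n x v a b F =
  map (λ γ → γ ++ (neg a ∷ neg b ∷ [])) F
  ++ concat (L.tabulate {n = n} λ i →
        (neg (x i) ∷ pos (v i) ∷ []) ∷ (pos (x i) ∷ pos (v i) ∷ []) ∷ [])
  ++ (L.tabulate {n = n} (λ i → neg (v i)) ++ (pos a ∷ []))
  ∷ (L.tabulate {n = n} (λ i → neg (v i)) ++ (pos b ∷ []))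
  ∷ []

allVec : (n : ℕ) → List (Vec Bool n)
allVec zero = [] ∷ []
allVec (suc n) = map (false ∷_) (allVec n) ++ map (true ∷_) (allVec n)

assignX : {n : ℕ} → (Fin n → ℕ) → Vec Bool n → PAssign
assignX {n} x bs = L.tabulate {n = n} λ i → lit (x i) (lookup bs i)

assignOn : (ℕ → Bool) → List ℕ → PAssign
assignOn τ ws = map (λ w → lit w (τ w)) ws

sum∞ : List ℕ∞ → ℕ∞
sum∞ [] = fin 0
sum∞ (m ∷ ms) = m +∞ sum∞ ms

InX : {n : ℕ} → (Fin n → ℕ) → ℕ → Set
InX x w = ∃ λ i → x i ≡ w

listX : {n : ℕ} → (Fin n → ℕ) → List ℕ
listX {n} x = L.tabulate {n = n} x

InXY : {n : ℕ} → (Fin n → ℕ) → List ℕ → ℕ → Set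
InXY x ys w = InX x w ⊎ w ∈ ys

InXYZ : {n : ℕ} → (Fin n → ℕ) → List ℕ → List ℕ → ℕ → Set
InXYZ x ys zs w = InX x w ⊎ w ∈ ys ⊎ w ∈ zs

-- While some x_i is unassigned, unit propagation in c_X(F) can neither conflict nor
-- remove x_i: setting every v_k with k ≠ i to true leaves only clauses with two open
-- literals, and every propagation stays below that assignment.  Once all of X is
-- set, propagation sets every v_k, then a and b, which satisfies the auxiliary
-- clauses and strips ¬a ∨ ¬b from the clauses of F, leaving exactly F|X'.  Hence a
-- DMST of c_X(F) of size s is simulated by trees T_X' of the F|X' with
-- Σ (|T_X'| + 1) ≤ s + 1 (a branch on Y is copied or skipped in each F|X'), and
-- conversely the complete tree on X with optimal trees for the F|X' at its leaves
-- has 2^n − 1 + Σ s(F|X') nodes.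

module Submission where

open import Defs
open import Data.Nat using (ℕ; zero; suc; _+_; _∸_; _^_; _≤_; _<_; z≤n; s≤s; s≤s⁻¹)
open import Data.Nat.Properties
  using ( ≡ᵇ⇒≡; ≡⇒≡ᵇ; ≤-refl; ≤-reflexive; ≤-trans; m≤n⇒m≤1+n; m≤m+n; m≤n+m; +-mono-≤; +-monoʳ-≤
        ; +-comm; +-suc; +-identityʳ; +-commutativeSemigroup; m∸n+n≡m; m^n>0; suc-injective)
open import Data.Bool using (Bool; true; false; not; _∨_; if_then_else_)
open import Data.Bool.Properties
  using (∨-assoc; ∨-comm; ∨-zeroʳ; ∨-identityʳ; ∨-conicalˡ; ∨-conicalʳ; not-involutive; not-¬; ¬-not; T-≡)
open import Data.Fin using (Fin; zero; suc; _≟_)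
import Data.Fin.Properties as Fin
open import Data.Fin.Properties using (0≢1+n)
open import Data.Vec using (Vec; []; _∷_; lookup; tabulate)
open import Data.Vec.Properties using (lookup∘tabulate; tabulate-cong; tabulate∘lookup)
open import Data.List using (List; []; _∷_; _++_; length; map; concat; filter)
open import Data.Nat.ListAction using (sum)
open import Data.Bool.ListAction using (any)
open import Data.Nat.ListAction.Properties using (sum-++)
import Data.List as L
open import Data.List.Properties using (++-identityʳ; map-++; map-∘; map-cong; length-++; length-map)
open import Data.List.Membership.Propositional using (_∈_; _∉_)
open import Data.List.Membership.Propositional.Properties
  using ( ∈-++⁻; ∈-++⁺ˡ; ∈-++⁺ʳ; ∈-map⁻; ∈-map⁺; ∈-concat⁻′; ∈-concat⁺′
        ; ∈-tabulate⁻; ∈-tabulate⁺; ∈-filter⁻; ∈-filter⁺; ∈-allFin)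
open import Data.List.Relation.Unary.Any using (here; there)
open import Data.Maybe using (just; nothing)
open import Data.Product using (Σ; _×_; _,_; proj₁; proj₂)
open import Data.Sum using (_⊎_; inj₁; inj₂; [_,_]′)
open import Data.Empty using (⊥; ⊥-elim)
open import Relation.Nullary using (¬_; Dec; yes; no)
open import Relation.Nullary.Decidable using (¬?)
open import Relation.Binary.PropositionalEquality
open import Function.Base using (id)
open import Function.Definitions using (Injective)
open import Function.Bundles using (Equivalence)
open import Algebra.Properties.CommutativeSemigroup +-commutativeSemigroup using (interchange; x∙yz≈y∙xz)

litEq-refl : ∀ l → litEq l l ≡ true
litEq-refl (pos x) = Equivalence.to T-≡ (≡⇒≡ᵇ x x refl)
litEq-refl (neg x) = Equivalence.to T-≡ (≡⇒≡ᵇ x x refl)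

litEq-sound : ∀ l m → litEq l m ≡ true → l ≡ m
litEq-sound (pos x) (pos y) e = cong pos (≡ᵇ⇒≡ x y (Equivalence.from T-≡ e))
litEq-sound (neg x) (neg y) e = cong neg (≡ᵇ⇒≡ x y (Equivalence.from T-≡ e))

compl-involutive : ∀ l → compl (compl l) ≡ l
compl-involutive (pos x) = refl
compl-involutive (neg x) = refl

compl-≢ : ∀ l → compl l ≢ l
compl-≢ (pos x) ()
compl-≢ (neg x) ()

compl-lit : ∀ w c → compl (lit w c) ≡ lit w (not c)
compl-lit w true = refl
compl-lit w false = refl

var-lit : ∀ w c → var (lit w c) ≡ w
var-lit w true = refl
var-lit w false = refl

var-compl : ∀ m → var (compl m) ≡ var m
var-compl (pos w) = refl
var-compl (neg w) = refl

lit-injective : ∀ p q d e → lit p d ≡ lit q e → (p ≡ q) × (d ≡ e)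
lit-injective p q true true refl = refl , refl
lit-injective p q false false refl = refl , refl
lit-injective p q true false ()
lit-injective p q false true ()

∨-≡true⁻ : ∀ a b → a ∨ b ≡ true → (a ≡ true) ⊎ (b ≡ true)
∨-≡true⁻ true b _ = inj₁ refl
∨-≡true⁻ false b e = inj₂ e

false≢true : false ≢ true
false≢true ()

memLit-++ : ∀ l I J → memLit l (I ++ J) ≡ (memLit l I ∨ memLit l J)
memLit-++ l [] J = refl
memLit-++ l (m ∷ I) J rewrite memLit-++ l I J = sym (∨-assoc (litEq l m) (memLit l I) (memLit l J))

memLit→∈ : ∀ l I → memLit l I ≡ true → l ∈ I
memLit→∈ l (m ∷ I) e with ∨-≡true⁻ (litEq l m) (memLit l I) e
... | inj₁ h = here (litEq-sound l m h)
... | inj₂ h = there (memLit→∈ l I h)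

∈→memLit : ∀ l I → l ∈ I → memLit l I ≡ true
∈→memLit l (m ∷ I) (here refl) rewrite litEq-refl l = refl
∈→memLit l (m ∷ I) (there p) rewrite ∈→memLit l I p = ∨-zeroʳ (litEq l m)

memLit-head : ∀ l I → memLit l (l ∷ I) ≡ true
memLit-head l I rewrite litEq-refl l = refl

memLit-there : ∀ q l A → memLit q A ≡ true → memLit q (l ∷ A) ≡ true
memLit-there q l A e rewrite e = ∨-zeroʳ _

memLit-++-false : ∀ q I J → memLit q I ≡ false → memLit q J ≡ false → memLit q (I ++ J) ≡ false
memLit-++-false q I J e1 e2 rewrite memLit-++ q I J | e1 | e2 = refl

memLit-++⁺ˡ : ∀ q I J → memLit q I ≡ true → memLit q (I ++ J) ≡ true
memLit-++⁺ˡ q I J e rewrite memLit-++ q I J | e = refl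

memLit-++⁺ʳ : ∀ q I J → memLit q J ≡ true → memLit q (I ++ J) ≡ true
memLit-++⁺ʳ q I J e rewrite memLit-++ q I J | e = ∨-zeroʳ _

memLit-tabulate⁻ : ∀ {k} (f : Fin k → Lit) q → memLit q (L.tabulate f) ≡ true → Σ (Fin k) λ j → q ≡ f j
memLit-tabulate⁻ f q e = ∈-tabulate⁻ (memLit→∈ q _ e)

memLit-tabulate⁺ : ∀ {k} (f : Fin k → Lit) j → memLit (f j) (L.tabulate f) ≡ true
memLit-tabulate⁺ f j = ∈→memLit (f j) _ (∈-tabulate⁺ j)

memLit-lit-false : ∀ A w → (memLit (pos w) A ≡ false) × (memLit (neg w) A ≡ false) → ∀ c → memLit (lit w c) A ≡ false
memLit-lit-false A w h true = proj₁ h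
memLit-lit-false A w h false = proj₂ h

_⊆L_ : List Lit → List Lit → Set
I ⊆L J = ∀ q → memLit q I ≡ true → memLit q J ≡ true

⊆L-antisym : ∀ I J → I ⊆L J → J ⊆L I → ∀ m → memLit m I ≡ memLit m J
⊆L-antisym I J a b m with memLit m I in e1 | memLit m J in e2
... | true | true = refl
... | false | false = refl
... | true | false with () <- trans (sym (a m e1)) e2
... | false | true with () <- trans (sym (b m e2)) e1

⊆L-false : ∀ {M K} → M ⊆L K → ∀ q → memLit q K ≡ false → memLit q M ≡ false
⊆L-false s q e = ¬-not λ e' → false≢true (trans (sym e) (s q e'))

memLit-++-⊆L : ∀ I J → I ⊆L J → ∀ m → memLit m (I ++ J) ≡ memLit m J
memLit-++-⊆L I J s m rewrite memLit-++ m I J with memLit m I in e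
... | true = sym (s m e)
... | false = refl

singleton-⊆L : ∀ l L → memLit l L ≡ true → (l ∷ []) ⊆L L
singleton-⊆L l L e q h with ∨-≡true⁻ (litEq q l) false h
... | inj₁ h' rewrite litEq-sound q l h' = e

NoClash : List Lit → List Lit → Set
NoClash I J = ∀ m → memLit m J ≡ true → memLit (compl m) I ≡ true → ⊥

Consistent : List Lit → Set
Consistent K = ∀ q → memLit q K ≡ true → memLit (compl q) K ≡ true → ⊥

consistent-singleton : ∀ l → Consistent (l ∷ [])
consistent-singleton l q a b with ∨-≡true⁻ (litEq q l) false a | ∨-≡true⁻ (litEq (compl q) l) false b
... | inj₁ a' | inj₁ b' rewrite litEq-sound q l a' = compl-≢ l (litEq-sound (compl l) l b')

satByI-cong : ∀ I J C → (∀ m → m ∈ C → memLit m I ≡ memLit m J) → satByI I C ≡ satByI J C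
satByI-cong I J [] h = refl
satByI-cong I J (l ∷ C) h rewrite h l (here refl) | satByI-cong I J C (λ m p → h m (there p)) = refl

shrink-cong : ∀ I J C → (∀ m → m ∈ C → memLit (compl m) I ≡ memLit (compl m) J) → shrink I C ≡ shrink J C
shrink-cong I J [] h = refl
shrink-cong I J (l ∷ C) h rewrite h l (here refl) | shrink-cong I J C (λ m p → h m (there p)) = refl

restrict-cong-on : ∀ I J G → (∀ C m → C ∈ G → m ∈ C → (memLit m I ≡ memLit m J) × (memLit (compl m) I ≡ memLit (compl m) J)) →
                   G ∣ I ≡ G ∣ J
restrict-cong-on I J [] h = refl
restrict-cong-on I J (C ∷ G) h
  rewrite satByI-cong I J C (λ m p → proj₁ (h C m (here refl) p))
        | shrink-cong I J C (λ m p → proj₂ (h C m (here refl) p))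
        | restrict-cong-on I J G (λ C' m q p → h C' m (there q) p) = refl

restrict-cong : ∀ I J G → (∀ m → memLit m I ≡ memLit m J) → G ∣ I ≡ G ∣ J
restrict-cong I J G h = restrict-cong-on I J G (λ C m _ _ → h m , h (compl m))

restrict-++-comm : ∀ I J G → G ∣ (I ++ J) ≡ G ∣ (J ++ I)
restrict-++-comm I J G = restrict-cong (I ++ J) (J ++ I) G λ m →
  trans (memLit-++ m I J) (trans (∨-comm (memLit m I) (memLit m J)) (sym (memLit-++ m J I)))

satByI-[] : ∀ C → satByI [] C ≡ false
satByI-[] [] = refl
satByI-[] (l ∷ C) = satByI-[] C

shrink-[] : ∀ C → shrink [] C ≡ C
shrink-[] [] = refl
shrink-[] (l ∷ C) = cong (l ∷_) (shrink-[] C)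

restrict-[] : ∀ G → G ∣ [] ≡ G
restrict-[] [] = refl
restrict-[] (C ∷ G) rewrite satByI-[] C | shrink-[] C | restrict-[] G = refl

restrict-mem⁻ : ∀ G I C' → C' ∈ G ∣ I → Σ Clause λ C → C ∈ G × satByI I C ≡ false × shrink I C ≡ C'
restrict-mem⁻ (C ∷ G) I C' p with satByI I C in eq
... | true = let (D , q , r , s) = restrict-mem⁻ G I C' p in D , there q , r , s
restrict-mem⁻ (C ∷ G) I C' (here refl) | false = C , here refl , eq , refl
restrict-mem⁻ (C ∷ G) I C' (there p) | false = let (D , q , r , s) = restrict-mem⁻ G I C' p in D , there q , r , s

restrict-mem⁺ : ∀ G I C → C ∈ G → satByI I C ≡ false → shrink I C ∈ G ∣ I
restrict-mem⁺ (D ∷ G) I C (here refl) e rewrite e = here refl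
restrict-mem⁺ (D ∷ G) I C (there p) e with satByI I D
... | true = restrict-mem⁺ G I C p e
... | false = there (restrict-mem⁺ G I C p e)

satByI-true⁻ : ∀ I C → satByI I C ≡ true → Σ Lit λ m → m ∈ C × memLit m I ≡ true
satByI-true⁻ I (l ∷ C) e with ∨-≡true⁻ (memLit l I) (satByI I C) e
... | inj₁ h = l , here refl , h
... | inj₂ h = let (m , p , q) = satByI-true⁻ I C h in m , there p , q

satByI-false⁻ : ∀ I C m → satByI I C ≡ false → m ∈ C → memLit m I ≡ false
satByI-false⁻ I (l ∷ C) m e (here refl) = ∨-conicalˡ (memLit l I) (satByI I C) e
satByI-false⁻ I (l ∷ C) m e (there p) = satByI-false⁻ I C m (∨-conicalʳ (memLit l I) (satByI I C) e) p

satByI-true⁺ : ∀ I C m → m ∈ C → memLit m I ≡ true → satByI I C ≡ true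
satByI-true⁺ I (l ∷ C) m (here refl) e rewrite e = refl
satByI-true⁺ I (l ∷ C) m (there p) e rewrite satByI-true⁺ I C m p e = ∨-zeroʳ (memLit l I)

shrink-mem⁻ : ∀ I C m → m ∈ shrink I C → m ∈ C × memLit (compl m) I ≡ false
shrink-mem⁻ I (l ∷ C) m p with memLit (compl l) I in eq
... | true = let (q , r) = shrink-mem⁻ I C m p in there q , r
shrink-mem⁻ I (l ∷ C) m (here refl) | false = here refl , eq
shrink-mem⁻ I (l ∷ C) m (there p) | false = let (q , r) = shrink-mem⁻ I C m p in there q , r

shrink-mem⁺ : ∀ I C m → m ∈ C → memLit (compl m) I ≡ false → m ∈ shrink I C
shrink-mem⁺ I (l ∷ C) m (here refl) e rewrite e = here refl
shrink-mem⁺ I (l ∷ C) m (there p) e with memLit (compl l) I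
... | true = shrink-mem⁺ I C m p e
... | false = there (shrink-mem⁺ I C m p e)

shrink-length-antitone : ∀ I J C → I ⊆L J → length (shrink J C) ≤ length (shrink I C)
shrink-length-antitone I J [] h = z≤n
shrink-length-antitone I J (l ∷ C) h with memLit (compl l) I in eI | memLit (compl l) J in eJ
... | true | true = shrink-length-antitone I J C h
... | true | false with () <- trans (sym (h (compl l) eI)) eJ
... | false | true = m≤n⇒m≤1+n (shrink-length-antitone I J C h)
... | false | false = s≤s (shrink-length-antitone I J C h)

shrink-∘ : ∀ I J C → shrink J (shrink I C) ≡ shrink (I ++ J) C
shrink-∘ I J [] = refl
shrink-∘ I J (l ∷ C) rewrite memLit-++ (compl l) I J with memLit (compl l) I
... | true = shrink-∘ I J C
... | false with memLit (compl l) J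
... | true = shrink-∘ I J C
... | false = cong (l ∷_) (shrink-∘ I J C)

satByI-∪ : ∀ I J C → satByI (I ++ J) C ≡ (satByI I C ∨ satByI J C)
satByI-∪ I J [] = refl
satByI-∪ I J (l ∷ C) rewrite memLit-++ l I J | satByI-∪ I J C with memLit l I | memLit l J | satByI I C | satByI J C
... | true | _ | _ | _ = refl
... | false | true | _ | _ = sym (∨-zeroʳ _)
... | false | false | true | _ = refl
... | false | false | false | _ = refl

satByI-shrink : ∀ I J C → NoClash I J → satByI J (shrink I C) ≡ satByI J C
satByI-shrink I J [] d = refl
satByI-shrink I J (l ∷ C) d with memLit (compl l) I in eI
... | false = cong (memLit l J ∨_) (satByI-shrink I J C d)
... | true with memLit l J in eJ
... | true = ⊥-elim (d l eJ eI)
... | false = satByI-shrink I J C d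

restrict-∘ : ∀ I J G → NoClash I J → (G ∣ I) ∣ J ≡ G ∣ (I ++ J)
restrict-∘ I J [] d = refl
restrict-∘ I J (C ∷ G) d rewrite satByI-∪ I J C with satByI I C
... | true = restrict-∘ I J G d
... | false rewrite satByI-shrink I J C d | shrink-∘ I J C with satByI J C
... | true = restrict-∘ I J G d
... | false = cong (shrink (I ++ J) C ∷_) (restrict-∘ I J G d)
restrict-++ : ∀ P Q I → (P ++ Q) ∣ I ≡ (P ∣ I) ++ (Q ∣ I)
restrict-++ [] Q I = refl
restrict-++ (C ∷ P) Q I with satByI I C
... | true = restrict-++ P Q I
... | false = cong (shrink I C ∷_) (restrict-++ P Q I)

satByI-++ : ∀ I P Q → satByI I (P ++ Q) ≡ (satByI I P ∨ satByI I Q)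
satByI-++ I [] Q = refl
satByI-++ I (l ∷ P) Q rewrite satByI-++ I P Q with memLit l I
... | true = refl
... | false = refl

shrink-++ : ∀ I P Q → shrink I (P ++ Q) ≡ shrink I P ++ shrink I Q
shrink-++ I [] Q = refl
shrink-++ I (l ∷ P) Q with memLit (compl l) I
... | true = shrink-++ I P Q
... | false = cong (l ∷_) (shrink-++ I P Q)

satByI-false⁺ : ∀ J C → (∀ m → m ∈ C → memLit m J ≡ false) → satByI J C ≡ false
satByI-false⁺ J [] h = refl
satByI-false⁺ J (l ∷ C) h rewrite h l (here refl) = satByI-false⁺ J C (λ m p → h m (there p))

shrink-all : ∀ J C → (∀ m → m ∈ C → memLit (compl m) J ≡ true) → shrink J C ≡ []
shrink-all J [] h = refl
shrink-all J (l ∷ C) h rewrite h l (here refl) = shrink-all J C (λ m p → h m (there p))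

restrict-all-satisfied : ∀ P J → (∀ C → C ∈ P → satByI J C ≡ true) → P ∣ J ≡ []
restrict-all-satisfied [] J h = refl
restrict-all-satisfied (C ∷ P) J h rewrite h C (here refl) = restrict-all-satisfied P J (λ C' p → h C' (there p))

∈Var-lit : ∀ {G C} m → C ∈ G → m ∈ C → var m ∈Var G
∈Var-lit (pos w) C∈G m∈C = _ , C∈G , inj₁ m∈C
∈Var-lit (neg w) C∈G m∈C = _ , C∈G , inj₂ m∈C

restrict-absent : ∀ G l → ¬ (var l ∈Var G) → G ∣ (l ∷ []) ≡ G
restrict-absent G l absent = trans (restrict-cong-on (l ∷ []) [] G unaffected) (restrict-[] G)
  where
    litEq-absent : ∀ m → var m ≢ var l → litEq m l ∨ false ≡ false
    litEq-absent m ne = cong (_∨ false) (¬-not λ e → ne (cong var (litEq-sound m l e)))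
    unaffected : ∀ C m → C ∈ G → m ∈ C → (memLit m (l ∷ []) ≡ false) × (memLit (compl m) (l ∷ []) ≡ false)
    unaffected C m C∈G m∈C =
      litEq-absent m (λ e → absent (subst (_∈Var G) e (∈Var-lit m C∈G m∈C))) ,
      litEq-absent (compl m) (λ e → absent (subst (_∈Var G) (trans (sym (var-compl m)) e) (∈Var-lit m C∈G m∈C)))

-- Unit propagation

-- The literals set by successive unit propagations, the most recent first.
data Propagation (H : Formula) : List Lit → Set where
  none : Propagation H []
  step : ∀ {m M} → (m ∷ []) ∈ H ∣ M → Propagation H M → Propagation H (m ∷ M)

UnitFree : Formula → Set
UnitFree H = ∀ l → (l ∷ []) ∈ H → ⊥

EmptyFree : Formula → Set
EmptyFree H = [] ∈ H → ⊥

restrict-unassigned : ∀ G I C' m → C' ∈ G ∣ I → m ∈ C' → (memLit m I ≡ false) × (memLit (compl m) I ≡ false)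
restrict-unassigned G I C' m p q with restrict-mem⁻ G I C' p
... | C , Cin , sf , refl = let (q1 , q2) = shrink-mem⁻ I C m q in satByI-false⁻ I C m sf q1 , q2

unit-clause-origin : ∀ H M m → (m ∷ []) ∈ H ∣ M →
                     Σ Clause λ C → C ∈ H × satByI M C ≡ false × shrink M C ≡ m ∷ [] × m ∈ C × memLit (compl m) M ≡ false
unit-clause-origin H M m u with restrict-mem⁻ H M (m ∷ []) u
... | C , Cin , sf , sh =
  let (q1 , q2) = shrink-mem⁻ M C m (subst (m ∈_) (sym sh) (here refl)) in C , Cin , sf , sh , q1 , q2

propagation-occurs : ∀ H M q → Propagation H M → memLit q M ≡ true → Σ Clause λ C → C ∈ H × q ∈ C
propagation-occurs H (m ∷ M) q (step u d) e with ∨-≡true⁻ (litEq q m) (memLit q M) e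
... | inj₂ h = propagation-occurs H M q d h
... | inj₁ h with litEq-sound q m h
... | refl with restrict-mem⁻ H M (m ∷ []) u
... | C , Cin , sf , sh = C , Cin , proj₁ (shrink-mem⁻ M C m (subst (m ∈_) (sym sh) (here refl)))

propagation-noClash : ∀ G I M → Propagation (G ∣ I) M → NoClash I M
propagation-noClash G I M d q e e' with propagation-occurs (G ∣ I) M q d e
... | C' , p , r with () <- trans (sym e') (proj₂ (restrict-unassigned G I C' q p r))

propagation-consistent : ∀ H M → Propagation H M → Consistent M
propagation-consistent H (m ∷ M) (step u d) q e1 e2 with unit-clause-origin H M m u
... | C , Cin , sf , sh , mC , cm with ∨-≡true⁻ (litEq q m) (memLit q M) e1 | ∨-≡true⁻ (litEq (compl q) m) (memLit (compl q) M) e2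
... | inj₁ h | inj₁ h' rewrite litEq-sound q m h = compl-≢ m (litEq-sound (compl m) m h')
... | inj₁ h | inj₂ h' rewrite litEq-sound q m h with () <- trans (sym h') cm
... | inj₂ h | inj₁ h' with litEq-sound (compl q) m h'
... | refl rewrite compl-involutive q with () <- trans (sym h) cm
propagation-consistent H (m ∷ M) (step u d) q e1 e2 | C , Cin , sf , sh , mC , cm | inj₂ h | inj₂ h' = propagation-consistent H M d q h h'

propagation-++ : ∀ G I M → Propagation (G ∣ I) M → Propagation G I → Propagation G (M ++ I)
propagation-++ G I [] none dI = dI
propagation-++ G I (m ∷ M) (step u d) dI =
  step (subst ((m ∷ []) ∈_) (trans (restrict-∘ I M G (propagation-noClash G I M d)) (restrict-++-comm I M G)) u) (propagation-++ G I M d dI)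

short-clause-absurd : ∀ H C' → C' ∈ H → length C' ≤ 1 → UnitFree H → EmptyFree H → ⊥
short-clause-absurd H [] p le nu ne = ne p
short-clause-absurd H (l ∷ []) p le nu ne = nu l p
short-clause-absurd H (l ∷ m ∷ C) p (s≤s ()) nu ne

-- Under K the clause that forced m is either short, contradicting the fixpoint, or
-- satisfied; and m is the only literal of it that M leaves open.
propagation⊆fixpoint : ∀ H M K → Propagation H M → Consistent K → UnitFree (H ∣ K) → EmptyFree (H ∣ K) → M ⊆L K
propagation⊆fixpoint H (m ∷ M) K (step u d) cK nu ne q e with ∨-≡true⁻ (litEq q m) (memLit q M) e
... | inj₂ h = propagation⊆fixpoint H M K d cK nu ne q h
... | inj₁ h with litEq-sound q m h
... | refl with unit-clause-origin H M m u
... | C , Cin , sf , sh , mC , cm with satByI K C in eK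
... | false = ⊥-elim (short-clause-absurd (H ∣ K) (shrink K C) (restrict-mem⁺ H K C Cin eK)
                 (subst (λ z → length (shrink K C) ≤ length z) sh (shrink-length-antitone M K C (propagation⊆fixpoint H M K d cK nu ne))) nu ne)
... | true with satByI-true⁻ K C eK
... | r , rC , rK with memLit (compl r) M in er
... | true = ⊥-elim (cK r rK (propagation⊆fixpoint H M K d cK nu ne (compl r) er))
... | false with subst (r ∈_) sh (shrink-mem⁺ M C r rC er)
... | here refl = rK

emptyFree-below-fixpoint : ∀ H M K → M ⊆L K → Consistent K → UnitFree (H ∣ K) → EmptyFree (H ∣ K) → EmptyFree (H ∣ M)
emptyFree-below-fixpoint H M K sub cK nu ne p with restrict-mem⁻ H M [] p
... | C , Cin , sf , sh with satByI K C in eK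
... | false = short-clause-absurd (H ∣ K) (shrink K C) (restrict-mem⁺ H K C Cin eK)
                 (≤-trans (subst (λ z → length (shrink K C) ≤ length z) sh (shrink-length-antitone M K C sub)) z≤n) nu ne
... | true with satByI-true⁻ K C eK
... | r , rC , rK with memLit (compl r) M in er
... | true = cK r rK (sub (compl r) er)
... | false with subst (r ∈_) sh (shrink-mem⁺ M C r rC er)
... | ()

propagation-below-fixpoint : ∀ H L K → Propagation H L → Consistent K → UnitFree (H ∣ K) → EmptyFree (H ∣ K) → (L ⊆L K) × EmptyFree (H ∣ L)
propagation-below-fixpoint H L K d c nu ne = let s = propagation⊆fixpoint H L K d c nu ne in s , emptyFree-below-fixpoint H L K s c nu ne

fixpoint-unique : ∀ H L M → Propagation H L → Propagation H M → UnitFree (H ∣ L) → UnitFree (H ∣ M) → EmptyFree (H ∣ L) →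
                  H ∣ L ≡ H ∣ M
fixpoint-unique H L M dL dM nuL nuM neL = restrict-cong L M H (⊆L-antisym L M L⊆M (proj₁ M-below))
  where
    M-below : (M ⊆L L) × EmptyFree (H ∣ M)
    M-below = propagation-below-fixpoint H M L dM (propagation-consistent H L dL) nuL neL
    L⊆M : L ⊆L M
    L⊆M = proj₁ (propagation-below-fixpoint H L M dL (propagation-consistent H M dM) nuM (proj₂ M-below))

Wide : Clause → Set
Wide C = Σ Lit λ p → Σ Lit λ q → p ∈ C × q ∈ C × p ≢ q

wide-clauses⇒fixpoint : ∀ H → (∀ C → C ∈ H → Wide C) → UnitFree H × EmptyFree H
wide-clauses⇒fixpoint H wide = (λ l u → not-unit l (wide (l ∷ []) u)) , (λ u → not-empty (wide [] u))
  where
    not-unit : ∀ l → ¬ Wide (l ∷ [])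
    not-unit l (p , q , here refl , here refl , p≢q) = p≢q refl
    not-empty : ¬ Wide []
    not-empty (p , q , () , _)

[]∈? : (H : Formula) → Dec ([] ∈ H)
[]∈? [] = no (λ ())
[]∈? ([] ∷ H) = yes (here refl)
[]∈? ((l ∷ C) ∷ H) with []∈? H
... | yes p = yes (there p)
... | no np = no λ { (there p) → np p }

∈Var? : ∀ w G → Dec (w ∈Var G)
∈Var? w [] = no λ { (C , () , _) }
∈Var? w (C ∷ G) with memLit (pos w) C in e1 | memLit (neg w) C in e2
... | true | _ = yes (C , here refl , inj₁ (memLit→∈ _ _ e1))
... | false | true = yes (C , here refl , inj₂ (memLit→∈ _ _ e2))
... | false | false with ∈Var? w G
...   | yes (C' , p , q) = yes (C' , there p , q)
...   | no nv = no f
  where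
    f : w ∈Var (C ∷ G) → ⊥
    f (C' , here refl , inj₁ q) with () <- trans (sym e1) (∈→memLit _ _ q)
    f (C' , here refl , inj₂ q) with () <- trans (sym e2) (∈→memLit _ _ q)
    f (C' , there p , q) = nv (C' , p , q)

∈Var-restrict-unassigned : ∀ G L w → w ∈Var (G ∣ L) → (memLit (pos w) L ≡ false) × (memLit (neg w) L ≡ false)
∈Var-restrict-unassigned G L w (C , p , inj₁ q) = restrict-unassigned G L C (pos w) p q
∈Var-restrict-unassigned G L w (C , p , inj₂ q) = let (a , b) = restrict-unassigned G L C (neg w) p q in b , a

propagation-++-consistent : ∀ G I M → Consistent I → Propagation (G ∣ I) M → Consistent (M ++ I)
propagation-++-consistent G I M cI dM q e1 e2
  rewrite memLit-++ q M I | memLit-++ (compl q) M I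
  with ∨-≡true⁻ (memLit q M) (memLit q I) e1 | ∨-≡true⁻ (memLit (compl q) M) (memLit (compl q) I) e2
... | inj₁ a | inj₁ b = propagation-consistent (G ∣ I) M dM q a b
... | inj₁ a | inj₂ b = propagation-noClash G I M dM q a b
... | inj₂ a | inj₁ b = propagation-noClash G I M dM (compl q) b (subst (λ z → memLit z I ≡ true) (sym (compl-involutive q)) a)
... | inj₂ a | inj₂ b = cI q a b

findUnit-just : ∀ G l → findUnit G ≡ just l → (l ∷ []) ∈ G
findUnit-just ([] ∷ G) l e = there (findUnit-just G l e)
findUnit-just ((m ∷ []) ∷ G) l refl = here refl
findUnit-just ((m ∷ m' ∷ C) ∷ G) l e = there (findUnit-just G l e)

findUnit-nothing : ∀ G → findUnit G ≡ nothing → UnitFree G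
findUnit-nothing ([] ∷ G) e l (there p) = findUnit-nothing G e l p
findUnit-nothing ((m ∷ []) ∷ G) () l p
findUnit-nothing ((m ∷ m' ∷ C) ∷ G) e l (there p) = findUnit-nothing G e l p

restrict-length-≤ : ∀ G I → length (G ∣ I) ≤ length G
restrict-length-≤ [] I = z≤n
restrict-length-≤ (C ∷ G) I with satByI I C
... | true = m≤n⇒m≤1+n (restrict-length-≤ G I)
... | false = s≤s (restrict-length-≤ G I)

restrict-length-< : ∀ G I C → C ∈ G → satByI I C ≡ true → length (G ∣ I) < length G
restrict-length-< (D ∷ G) I C (here refl) e rewrite e = s≤s (restrict-length-≤ G I)
restrict-length-< (D ∷ G) I C (there p) e with satByI I D
... | true = m≤n⇒m≤1+n (restrict-length-< G I C p e)
... | false = s≤s (restrict-length-< G I C p e)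

upT-spec : ∀ k G → length G ≤ k → Σ (List Lit) λ L → Propagation G L × UnitFree (G ∣ L) × proj₂ (upT k G) ≡ G ∣ L
upT-spec zero [] le = [] , none , (λ l ()) , refl
upT-spec (suc k) G le with findUnit G in eq
... | nothing = [] , none , subst UnitFree (sym (restrict-[] G)) (findUnit-nothing G eq) , sym (restrict-[] G)
... | just l with upT-spec k (G ∣ (l ∷ [])) (s≤s⁻¹ (≤-trans shorter le))
  where
    shorter : length (G ∣ (l ∷ [])) < length G
    shorter = restrict-length-< G (l ∷ []) (l ∷ []) (findUnit-just G l eq) (cong (_∨ false) (memLit-head l []))
... | L' , d' , nu' , eq' = L' ++ (l ∷ []) ,
    propagation-++ G (l ∷ []) L' d' (step (subst ((l ∷ []) ∈_) (sym (restrict-[] G)) (findUnit-just G l eq)) none) ,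
    subst UnitFree eqR nu' ,
    trans eq' eqR
  where
    eqR : (G ∣ (l ∷ [])) ∣ L' ≡ G ∣ (L' ++ (l ∷ []))
    eqR = trans (restrict-∘ (l ∷ []) L' G (propagation-noClash G (l ∷ []) L' d')) (restrict-++-comm (l ∷ []) L' G)

U-spec : ∀ G → Σ (List Lit) λ L → Propagation G L × UnitFree (G ∣ L) × U G ≡ G ∣ L
U-spec G = upT-spec (length G) G ≤-refl

-- Formulas that DPLL-Mono cannot distinguish

-- Formulas are lists, so U of equivalent formulas agrees only as a set of clauses.
record _≋_ (G H : Formula) : Set where
  constructor _,_
  field
    ≋⇒ : ∀ C → C ∈ G → C ∈ H
    ≋⇐ : ∀ C → C ∈ H → C ∈ G
open _≋_

≋-refl : ∀ {G} → G ≋ G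
≋-refl = (λ C p → p) , (λ C p → p)

≋-reflexive : ∀ {G H} → G ≡ H → G ≋ H
≋-reflexive refl = ≋-refl

≋-sym : ∀ {G H} → G ≋ H → H ≋ G
≋-sym (a , b) = b , a

≋-trans : ∀ {G H K} → G ≋ H → H ≋ K → G ≋ K
≋-trans (a , b) (c , d) = (λ C p → c C (a C p)) , (λ C p → b C (d C p))

record _≈UP_ (G H : Formula) : Set where
  constructor mk≈UP
  field
    conflict⇒ : Conflict G → Conflict H
    conflict⇐ : Conflict H → Conflict G
    U-≋ : ¬ Conflict G → U G ≋ U H
open _≈UP_

≈UP-refl : ∀ {G} → G ≈UP G
≈UP-refl = mk≈UP (λ c → c) (λ c → c) (λ _ → ≋-refl)

≈UP-reflexive : ∀ {G H} → G ≡ H → G ≈UP H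
≈UP-reflexive refl = ≈UP-refl

≈UP-sym : ∀ {G H} → G ≈UP H → H ≈UP G
≈UP-sym (mk≈UP a b c) = mk≈UP b a λ nh → ≋-sym (c (λ cg → nh (a cg)))

≈UP-trans : ∀ {G H K} → G ≈UP H → H ≈UP K → G ≈UP K
≈UP-trans (mk≈UP a b c) (mk≈UP a' b' c') = mk≈UP (λ x → a' (a x)) (λ x → b (b' x))
  λ ng → ≋-trans (c ng) (c' (λ ch → ng (b ch)))

restrict-≋ : ∀ G H I → G ≋ H → (G ∣ I) ≋ (H ∣ I)
restrict-≋ G H I (a , b) = f G H a , f H G b
  where
    f : ∀ G H → (∀ C → C ∈ G → C ∈ H) → ∀ C → C ∈ G ∣ I → C ∈ H ∣ I
    f G H a C' p with restrict-mem⁻ G I C' p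
    ... | C , Cin , sf , refl = restrict-mem⁺ H I C (a C Cin) sf

propagation-≋ : ∀ G H L → G ≋ H → Propagation G L → Propagation H L
propagation-≋ G H [] e none = none
propagation-≋ G H (m ∷ L) e (step u d) = step (≋⇒ (restrict-≋ G H L e) (m ∷ []) u) (propagation-≋ G H L e d)

∈Var-≋ : ∀ {w G H} → G ≋ H → w ∈Var G → w ∈Var H
∈Var-≋ (a , b) (C , p , q) = C , a C p , q

conflict⇒[]∈ : ∀ G L → U G ≡ G ∣ L → Conflict G → [] ∈ G ∣ L
conflict⇒[]∈ G L e c = subst ([] ∈_) e c

[]∈⇒conflict : ∀ G L → U G ≡ G ∣ L → [] ∈ G ∣ L → Conflict G
[]∈⇒conflict G L e c = subst ([] ∈_) (sym e) c

conflict-≋ : ∀ G H → G ≋ H → Conflict G → Conflict H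
conflict-≋ G H e c with U-spec G | U-spec H
... | L , dL , nuL , eL | M , dM , nuM , eM with []∈? (H ∣ M)
... | yes p = []∈⇒conflict H M eM p
... | no np = ⊥-elim (proj₂ (propagation-below-fixpoint H L M (propagation-≋ G H L e dL) (propagation-consistent H M dM) nuM np)
                   (≋⇒ (restrict-≋ G H L e) [] (conflict⇒[]∈ G L eL c)))

≋⇒≈UP : ∀ G H → G ≋ H → G ≈UP H
≋⇒≈UP G H e = mk≈UP (conflict-≋ G H e) (conflict-≋ H G (≋-sym e)) U-same
  where
    U-same : ¬ Conflict G → U G ≋ U H
    U-same nc with U-spec G | U-spec H
    ... | L , dL , nuL , eL | M , dM , nuM , eM =
      ≋-trans (≋-reflexive eL) (≋-trans GL≋HL (≋-reflexive (trans HL≡HM (sym eM))))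
      where
        GL≋HL : (G ∣ L) ≋ (H ∣ L)
        GL≋HL = restrict-≋ G H L e
        HL≡HM : H ∣ L ≡ H ∣ M
        HL≡HM = fixpoint-unique H L M (propagation-≋ G H L e dL) dM
                  (λ l p → nuL l (≋⇐ GL≋HL (l ∷ []) p)) nuM (λ p → nc ([]∈⇒conflict G L eL (≋⇐ GL≋HL [] p)))

DMST-≈UP : ∀ {B G H T} → DMST B G T → G ≈UP H → DMST B H T
DMST-≈UP (dleaf c) s = dleaf (conflict⇒ s c)
DMST-≈UP {B} {G} {H} (dnode {x = x} nc xv bx d1 d2) s =
  dnode (λ ch → nc (conflict⇐ s ch)) (∈Var-≋ e xv) bx
        (DMST-≈UP d1 (≋⇒≈UP _ _ (restrict-≋ (U G) (U H) (neg x ∷ []) e)))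
        (DMST-≈UP d2 (≋⇒≈UP _ _ (restrict-≋ (U G) (U H) (pos x ∷ []) e)))
  where e = U-≋ s nc

restrict-forced : ∀ G I → Consistent I → (∀ L → Propagation G L → UnitFree (G ∣ L) → EmptyFree (G ∣ L) → I ⊆L L) → G ≈UP (G ∣ I)
restrict-forced G I cI forced with U-spec G | U-spec (G ∣ I)
... | L , dL , nuL , eL | M , dM , nuM , eM = mk≈UP conflict→ conflict← U-same
  where
    GI∣M≡ : (G ∣ I) ∣ M ≡ G ∣ (M ++ I)
    GI∣M≡ = trans (restrict-∘ I M G (propagation-noClash G I M dM)) (restrict-++-comm I M G)
    MI-below : ∀ {L} → Propagation G L → EmptyFree ((G ∣ I) ∣ M) → (L ⊆L (M ++ I)) × EmptyFree (G ∣ L)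
    MI-below dL' ne = propagation-below-fixpoint G _ (M ++ I) dL' (propagation-++-consistent G I M cI dM)
                        (subst UnitFree GI∣M≡ nuM) (subst EmptyFree GI∣M≡ ne)
    same-fixpoint : EmptyFree (G ∣ L) → EmptyFree ((G ∣ I) ∣ M) × (G ∣ L ≡ (G ∣ I) ∣ M)
    same-fixpoint ne = proj₂ M-below , trans (restrict-cong L (M ++ I) G (⊆L-antisym L (M ++ I) L⊆MI MI⊆L)) (sym GI∣M≡)
      where
        I⊆L : I ⊆L L
        I⊆L = forced L dL nuL ne
        GI∣L≡ : (G ∣ I) ∣ L ≡ G ∣ L
        GI∣L≡ = trans (restrict-∘ I L G (λ q qL cqI → propagation-consistent G L dL q qL (I⊆L (compl q) cqI)))
                      (restrict-cong (I ++ L) L G (memLit-++-⊆L I L I⊆L))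
        M-below : (M ⊆L L) × EmptyFree ((G ∣ I) ∣ M)
        M-below = propagation-below-fixpoint (G ∣ I) M L dM (propagation-consistent G L dL)
                    (subst UnitFree (sym GI∣L≡) nuL) (subst EmptyFree (sym GI∣L≡) ne)
        L⊆MI : L ⊆L (M ++ I)
        L⊆MI = proj₁ (MI-below dL (proj₂ M-below))
        MI⊆L : (M ++ I) ⊆L L
        MI⊆L q e with ∨-≡true⁻ (memLit q M) (memLit q I) (trans (sym (memLit-++ q M I)) e)
        ... | inj₁ q∈M = proj₁ M-below q q∈M
        ... | inj₂ q∈I = I⊆L q q∈I
    conflict→ : Conflict G → Conflict (G ∣ I)
    conflict→ c with []∈? ((G ∣ I) ∣ M)
    ... | yes p = []∈⇒conflict (G ∣ I) M eM p
    ... | no np = ⊥-elim (proj₂ (MI-below dL np) (conflict⇒[]∈ G L eL c))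
    conflict← : Conflict (G ∣ I) → Conflict G
    conflict← c with []∈? (G ∣ L)
    ... | yes p = []∈⇒conflict G L eL p
    ... | no np = ⊥-elim (proj₁ (same-fixpoint np) (conflict⇒[]∈ (G ∣ I) M eM c))
    U-same : ¬ Conflict G → U G ≋ U (G ∣ I)
    U-same nc = ≋-reflexive (trans eL (trans (proj₂ (same-fixpoint (λ p → nc ([]∈⇒conflict G L eL p)))) (sym eM)))

restrict-propagation : ∀ G I → Propagation G I → G ≈UP (G ∣ I)
restrict-propagation G I dI = restrict-forced G I (propagation-consistent G I dI)
  (λ L dL nu ne → proj₁ (propagation-below-fixpoint G I L dI (propagation-consistent G L dL) nu ne))

restrict-⊆propagation : ∀ G I L → Propagation G L → I ⊆L L → Consistent I → G ≈UP (G ∣ I)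
restrict-⊆propagation G I L dL s cI = restrict-forced G I cI
  (λ L' dL' nu ne q e → proj₁ (propagation-below-fixpoint G L L' dL (propagation-consistent G L' dL') nu ne) q (s q e))

≈UP-U : ∀ G → G ≈UP U G
≈UP-U G with U-spec G
... | L , dL , nuL , eL = ≈UP-trans (restrict-propagation G L dL) (≈UP-reflexive (sym eL))

restrict-propagation-comm : ∀ G l L → Propagation G L → memLit l L ≡ false → memLit (compl l) L ≡ false →
     (G ∣ (l ∷ [])) ≈UP ((G ∣ L) ∣ (l ∷ []))
restrict-propagation-comm G l L dL nl ncl = ≈UP-trans (restrict-forced (G ∣ (l ∷ [])) L (propagation-consistent G L dL) forced) (≈UP-reflexive eq)
  where
    forced : ∀ L' → Propagation (G ∣ (l ∷ [])) L' → UnitFree ((G ∣ (l ∷ [])) ∣ L') → EmptyFree ((G ∣ (l ∷ [])) ∣ L') → L ⊆L L'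
    forced L' d' nu ne q q∈L = [ id , l-absent ]′ (∨-≡true⁻ (memLit q L') (litEq q l ∨ false) q∈L'l)
      where
        eqL : (G ∣ (l ∷ [])) ∣ L' ≡ G ∣ (L' ++ (l ∷ []))
        eqL = trans (restrict-∘ (l ∷ []) L' G (propagation-noClash G (l ∷ []) L' d')) (restrict-++-comm (l ∷ []) L' G)
        L⊆L'l : L ⊆L (L' ++ (l ∷ []))
        L⊆L'l = proj₁ (propagation-below-fixpoint G L (L' ++ (l ∷ [])) dL (propagation-++-consistent G (l ∷ []) L' (consistent-singleton l) d')
                        (subst UnitFree eqL nu) (subst EmptyFree eqL ne))
        q∈L'l : memLit q L' ∨ (litEq q l ∨ false) ≡ true
        q∈L'l = trans (sym (memLit-++ q L' (l ∷ []))) (L⊆L'l q q∈L)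
        l-absent : (litEq q l ∨ false) ≡ true → memLit q L' ≡ true
        l-absent a with ∨-≡true⁻ (litEq q l) false a
        ... | inj₁ a' rewrite litEq-sound q l a' with () <- trans (sym q∈L) nl
    eq : (G ∣ (l ∷ [])) ∣ L ≡ (G ∣ L) ∣ (l ∷ [])
    eq = trans (restrict-∘ (l ∷ []) L G d1) (trans (restrict-++-comm (l ∷ []) L G) (sym (restrict-∘ L (l ∷ []) G d2)))
      where
        d1 : NoClash (l ∷ []) L
        d1 q qL cq with ∨-≡true⁻ (litEq (compl q) l) false cq
        ... | inj₁ h with litEq-sound (compl q) l h
        ... | refl rewrite compl-involutive q with () <- trans (sym qL) ncl
        d2 : NoClash L (l ∷ [])
        d2 q ql cq with ∨-≡true⁻ (litEq q l) false ql
        ... | inj₁ h rewrite litEq-sound q l h with () <- trans (sym cq) ncl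

U-branch≈UP : ∀ G x b → x ∈Var U G → (U G ∣ (lit x b ∷ [])) ≈UP (G ∣ (lit x b ∷ []))
U-branch≈UP G x b xv with U-spec G
... | L , dL , nuL , eL =
  ≈UP-sym (≈UP-trans (restrict-propagation-comm G (lit x b) L dL (f1 b) (f2 b)) (≈UP-reflexive (cong (_∣ (lit x b ∷ [])) (sym eL))))
  where
    vf : (memLit (pos x) L ≡ false) × (memLit (neg x) L ≡ false)
    vf = ∈Var-restrict-unassigned G L x (subst (x ∈Var_) eL xv)
    f1 : ∀ b → memLit (lit x b) L ≡ false
    f1 = memLit-lit-false L x vf
    f2 : ∀ b → memLit (compl (lit x b)) L ≡ false
    f2 b = subst (λ l → memLit l L ≡ false) (sym (compl-lit x b)) (f1 (not b))

restrict-nonvar≈UP : ∀ G y → ¬ (y ∈Var U G) → Σ Bool λ b → (G ∣ (lit y b ∷ [])) ≈UP G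
restrict-nonvar≈UP G y nv with U-spec G
... | L , dL , nuL , eL with memLit (pos y) L in e1 | memLit (neg y) L in e2
... | true | _ = true , ≈UP-sym (restrict-⊆propagation G (pos y ∷ []) L dL (singleton-⊆L (pos y) L e1) (consistent-singleton (pos y)))
... | false | true = false , ≈UP-sym (restrict-⊆propagation G (neg y ∷ []) L dL (singleton-⊆L (neg y) L e2) (consistent-singleton (neg y)))
... | false | false = true ,
    ≈UP-trans (restrict-propagation-comm G (pos y) L dL e1 e2)
      (≈UP-trans (≈UP-reflexive (trans (restrict-absent (G ∣ L) (pos y) (λ v → nv (subst (y ∈Var_) (sym eL) v))) (sym eL)))
                 (≈UP-sym (≈UP-U G)))

∈Var-U-restrict-unassigned : ∀ G A w → w ∈Var U (G ∣ A) → (memLit (pos w) A ≡ false) × (memLit (neg w) A ≡ false)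
∈Var-U-restrict-unassigned G A w wv with U-spec (G ∣ A)
... | M , dM , nuM , eM =
  let vf = ∈Var-restrict-unassigned G (A ++ M) w (subst (w ∈Var_) (trans eM (restrict-∘ A M G (propagation-noClash G A M dM))) wv)
  in ∨-conicalˡ _ _ (trans (sym (memLit-++ (pos w) A M)) (proj₁ vf)) ,
     ∨-conicalˡ _ _ (trans (sym (memLit-++ (neg w) A M)) (proj₂ vf))

branch≈UP : ∀ G A w c → w ∈Var U (G ∣ A) → (U (G ∣ A) ∣ (lit w c ∷ [])) ≈UP (G ∣ (lit w c ∷ A))
branch≈UP G A w c wv =
  ≈UP-trans (U-branch≈UP (G ∣ A) w c wv) (≈UP-reflexive (trans (restrict-∘ A (lit w c ∷ []) G dj) (restrict-++-comm A (lit w c ∷ []) G)))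
  where
    dj : NoClash A (lit w c ∷ [])
    dj q ql cq with ∨-≡true⁻ (litEq q (lit w c)) false ql
    ... | inj₁ h rewrite litEq-sound q (lit w c) h | compl-lit w c with () <- trans (sym cq) (memLit-lit-false A w (∈Var-U-restrict-unassigned G A w wv) (not c))

Realisation : (ℕ → Set) → Formula → ℕ → Tree → Tree → Set
Realisation B G w T1 T2 = Σ Tree λ T → (DMST B (G ∣ (neg w ∷ [])) T1 → DMST B (G ∣ (pos w ∷ [])) T2 → DMST B G T) ×
                                       (size T ≤ suc (size T1 + size T2))

-- If w has left Var(U G), one of its two restrictions is UP-equivalent to G, so
-- the corresponding child tree can replace the node.
branch-realisable : ∀ {B} G w → B w → (T1 T2 : Tree) → Realisation B G w T1 T2
branch-realisable G w bw T1 T2 with []∈? (U G)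
... | yes c = leaf , (λ _ _ → dleaf c) , z≤n
... | no nc with ∈Var? w (U G)
...   | yes wv = node w T1 T2 ,
               (λ d1 d2 → dnode nc wv bw (DMST-≈UP d1 (≈UP-sym (U-branch≈UP G w false wv)))
                                         (DMST-≈UP d2 (≈UP-sym (U-branch≈UP G w true wv)))) ,
               ≤-refl
...   | no nv with restrict-nonvar≈UP G w nv
...     | true , s = T2 , (λ _ d2 → DMST-≈UP d2 s) , m≤n⇒m≤1+n (m≤n+m _ _)
...     | false , s = T1 , (λ d1 _ → DMST-≈UP d1 s) , m≤n⇒m≤1+n (m≤m+n _ _)

module _ {A : Set} where

  sum-map-mono : ∀ (l : List A) f g → (∀ X → f X ≤ g X) → sum (map f l) ≤ sum (map g l)
  sum-map-mono [] f g h = z≤n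
  sum-map-mono (X ∷ l) f g h = +-mono-≤ (h X) (sum-map-mono l f g h)

  sum-map-+ : ∀ (l : List A) f g → sum (map (λ X → f X + g X) l) ≡ sum (map f l) + sum (map g l)
  sum-map-+ [] f g = refl
  sum-map-+ (X ∷ l) f g = trans (cong (f X + g X +_) (sum-map-+ l f g)) (interchange (f X) (g X) _ _)

  sum-map-cong : ∀ (l : List A) f g → (∀ X → f X ≡ g X) → sum (map f l) ≡ sum (map g l)
  sum-map-cong l f g h = cong sum (map-cong h l)

  sum-map-zero : ∀ (l : List A) f → (∀ X → f X ≡ 0) → sum (map f l) ≡ 0
  sum-map-zero [] f h = refl
  sum-map-zero (X ∷ l) f h rewrite h X = sum-map-zero l f h

  sum-map-suc : ∀ (l : List A) f → sum (map (λ X → suc (f X)) l) ≡ length l + sum (map f l)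
  sum-map-suc [] f = refl
  sum-map-suc (X ∷ l) f = cong suc (trans (cong (f X +_) (sum-map-suc l f)) (x∙yz≈y∙xz (f X) (length l) _))

any-false⁻ : ∀ {A : Set} (f : A → Bool) is i → any f is ≡ false → i ∈ is → f i ≡ false
any-false⁻ f (j ∷ is) i e (here refl) = ∨-conicalˡ _ _ e
any-false⁻ f (j ∷ is) i e (there p) = any-false⁻ f is i (∨-conicalʳ _ _ e) p

any-false⁺ : ∀ {A : Set} (f : A → Bool) is → (∀ i → f i ≡ false) → any f is ≡ false
any-false⁺ f [] h = refl
any-false⁺ f (i ∷ is) h rewrite h i = any-false⁺ f is h

sumVec : ∀ {m} → (Vec Bool m → ℕ) → ℕ
sumVec {m} f = sum (map f (allVec m))

sumVec-split : ∀ m (f : Vec Bool (suc m) → ℕ) → sumVec f ≡ sumVec (λ X → f (false ∷ X)) + sumVec (λ X → f (true ∷ X))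
sumVec-split m f = begin
  sum (map f (map (false ∷_) (allVec m) ++ map (true ∷_) (allVec m)))
    ≡⟨ cong sum (map-++ f (map (false ∷_) (allVec m)) _) ⟩
  sum (map f (map (false ∷_) (allVec m)) ++ map f (map (true ∷_) (allVec m)))
    ≡⟨ sum-++ (map f (map (false ∷_) (allVec m))) _ ⟩
  sum (map f (map (false ∷_) (allVec m))) + sum (map f (map (true ∷_) (allVec m)))
    ≡⟨ sym (cong₂ (λ p q → sum p + sum q) (map-∘ (allVec m)) (map-∘ (allVec m))) ⟩
  sumVec (λ X → f (false ∷ X)) + sumVec (λ X → f (true ∷ X)) ∎
  where open ≡-Reasoning

sumVec-single : ∀ m (f : Vec Bool m → ℕ) X0 → (∀ X → X ≢ X0 → f X ≡ 0) → sumVec f ≡ f X0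
sumVec-single zero f [] h = +-identityʳ (f [])
sumVec-single (suc m) f (false ∷ X0) h rewrite sumVec-split m f
  | sumVec-single m (λ X → f (false ∷ X)) X0 (λ X ne → h (false ∷ X) (λ { refl → ne refl }))
  | sum-map-zero (allVec m) (λ X → f (true ∷ X)) (λ X → h (true ∷ X) (λ ())) = +-identityʳ _
sumVec-single (suc m) f (true ∷ X0) h rewrite sumVec-split m f
  | sumVec-single m (λ X → f (true ∷ X)) X0 (λ X ne → h (true ∷ X) (λ { refl → ne refl }))
  | sum-map-zero (allVec m) (λ X → f (false ∷ X)) (λ X → h (false ∷ X) (λ ())) = refl

length-allVec : ∀ m → length (allVec m) ≡ 2 ^ m
length-allVec zero = refl
length-allVec (suc m) = begin
  length (map (false ∷_) (allVec m) ++ map (true ∷_) (allVec m))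
    ≡⟨ length-++ (map (false ∷_) (allVec m)) ⟩
  length (map (false ∷_) (allVec m)) + length (map (true ∷_) (allVec m))
    ≡⟨ cong₂ _+_ (length-map (false ∷_) (allVec m)) (length-map (true ∷_) (allVec m)) ⟩
  length (allVec m) + length (allVec m)
    ≡⟨ cong₂ _+_ (length-allVec m) (trans (length-allVec m) (sym (+-identityʳ (2 ^ m)))) ⟩
  2 ^ suc m ∎
  where open ≡-Reasoning

∈-allVec : ∀ m (X : Vec Bool m) → X ∈ allVec m
∈-allVec zero [] = here refl
∈-allVec (suc m) (false ∷ X) = ∈-++⁺ˡ (∈-map⁺ (false ∷_) (∈-allVec m X))
∈-allVec (suc m) (true ∷ X) = ∈-++⁺ʳ (map (false ∷_) (allVec m)) (∈-map⁺ (true ∷_) (∈-allVec m X))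

suc-[m∸1]+n : ∀ {m} n → 1 ≤ m → suc (m ∸ 1 + n) ≡ m + n
suc-[m∸1]+n n 1≤m = cong (_+ n) (trans (+-comm 1 _) (m∸n+n≡m 1≤m))

-- ∞ is sent to 0; only used on values known to be finite.
ℕ∞-toℕ : ℕ∞ → ℕ
ℕ∞-toℕ (fin m) = m
ℕ∞-toℕ ∞ = 0

sum∞-fin⁻ : ∀ {A : Set} (sv : A → ℕ∞) l S → sum∞ (map sv l) ≡ fin S →
            (∀ X → X ∈ l → sv X ≡ fin (ℕ∞-toℕ (sv X))) × (S ≡ sum (map (λ X → ℕ∞-toℕ (sv X)) l))
sum∞-fin⁻ sv [] S refl = (λ X ()) , refl
sum∞-fin⁻ sv (X ∷ l) S e with sv X in eX | sum∞ (map sv l) in el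
... | fin m | fin S' with refl ← e = finite , cong (m +_) (proj₂ (sum∞-fin⁻ sv l S' el))
  where
    finite : ∀ Y → Y ∈ X ∷ l → sv Y ≡ fin (ℕ∞-toℕ (sv Y))
    finite Y (here refl) rewrite eX = refl
    finite Y (there p) = proj₁ (sum∞-fin⁻ sv l S' el) Y p
sum∞-fin⁻ sv (X ∷ l) S () | fin m | ∞
sum∞-fin⁻ sv (X ∷ l) S () | ∞ | _

sum∞-∞⁻ : ∀ {A : Set} (sv : A → ℕ∞) l → sum∞ (map sv l) ≡ ∞ → Σ A λ X → sv X ≡ ∞
sum∞-∞⁻ sv (X ∷ l) e with sv X in eX | sum∞ (map sv l) in el
... | ∞ | _ = X , eX
... | fin m | ∞ = sum∞-∞⁻ sv l el
sum∞-∞⁻ sv (X ∷ l) () | fin m | fin _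

-- The formula c_X(F)

module Construction (n : ℕ) (x : Fin n → ℕ) (ys zs : List ℕ) (F : Formula)
  (x-injective : Injective _≡_ _≡_ x) (x∉ys : ∀ i → x i ∉ ys)
  (F-over-XYZ : ∀ w → w ∈Var F → InXYZ x ys zs w)
  (v : Fin n → ℕ) (a b : ℕ) (v-injective : Injective _≡_ _≡_ v) (a≢b : a ≢ b)
  (v≢a : ∀ i → v i ≢ a) (v≢b : ∀ i → v i ≢ b)
  (a-fresh : ¬ InXYZ x ys zs a) (b-fresh : ¬ InXYZ x ys zs b) (v-fresh : ∀ i → ¬ InXYZ x ys zs (v i)) where

  Branch : ℕ → Set
  Branch = InXY x ys

  cXF : Formula
  cXF = cX n x v a b F

  weakenedF : Formula
  weakenedF = map (λ γ → γ ++ (neg a ∷ neg b ∷ [])) F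

  xvPair : Fin n → Formula
  xvPair i = (neg (x i) ∷ pos (v i) ∷ []) ∷ (pos (x i) ∷ pos (v i) ∷ []) ∷ []

  xvClauses : Formula
  xvClauses = concat (L.tabulate xvPair)

  negVs : Clause
  negVs = L.tabulate {n = n} (λ i → neg (v i))

  clauseA clauseB : Clause
  clauseA = negVs ++ (pos a ∷ [])
  clauseB = negVs ++ (pos b ∷ [])

  auxClauses : Formula
  auxClauses = xvClauses ++ clauseA ∷ clauseB ∷ []

  data AuxShape : Clause → Set where
    xvShape : ∀ i c → AuxShape (lit (x i) c ∷ pos (v i) ∷ [])
    aShape : AuxShape clauseA
    bShape : AuxShape clauseB

  auxShape : ∀ C → C ∈ auxClauses → AuxShape C
  auxShape C p with ∈-++⁻ xvClauses p
  ... | inj₂ (here refl) = aShape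
  ... | inj₂ (there (here refl)) = bShape
  ... | inj₁ q with ∈-concat⁻′ _ q
  ... | xs , Cxs , xsin with ∈-tabulate⁻ {f = xvPair} xsin
  ... | i , refl with Cxs
  ... | here refl = xvShape i false
  ... | there (here refl) = xvShape i true

  data Shape : Clause → Set where
    weakShape : ∀ γ → γ ∈ F → Shape (γ ++ (neg a ∷ neg b ∷ []))
    fromAux : ∀ {C} → AuxShape C → Shape C

  shape : ∀ C → C ∈ cXF → Shape C
  shape C p with ∈-++⁻ weakenedF p
  ... | inj₂ q = fromAux (auxShape C q)
  ... | inj₁ q with ∈-map⁻ (λ γ → γ ++ (neg a ∷ neg b ∷ [])) q
  ... | γ , γF , refl = weakShape γ γF

  xvPair∈cXF : ∀ i c → (lit (x i) c ∷ pos (v i) ∷ []) ∈ cXF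
  xvPair∈cXF i false = ∈-++⁺ʳ weakenedF (∈-++⁺ˡ (∈-concat⁺′ (here refl) (∈-tabulate⁺ i)))
  xvPair∈cXF i true = ∈-++⁺ʳ weakenedF (∈-++⁺ˡ (∈-concat⁺′ (there (here refl)) (∈-tabulate⁺ i)))

  clauseA∈cXF : clauseA ∈ cXF
  clauseA∈cXF = ∈-++⁺ʳ weakenedF (∈-++⁺ʳ xvClauses (here refl))

  clauseB∈cXF : clauseB ∈ cXF
  clauseB∈cXF = ∈-++⁺ʳ weakenedF (∈-++⁺ʳ xvClauses (there (here refl)))

  F-var : ∀ γ m → γ ∈ F → m ∈ γ → InXYZ x ys zs (var m)
  F-var γ (pos w) g p = F-over-XYZ w (γ , g , inj₁ p)
  F-var γ (neg w) g p = F-over-XYZ w (γ , g , inj₂ p)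

  XY⊆XYZ : ∀ {w} → InXY x ys w → InXYZ x ys zs w
  XY⊆XYZ (inj₁ h) = inj₁ h
  XY⊆XYZ (inj₂ h) = inj₂ (inj₁ h)

  x∈XYZ : ∀ i → InXYZ x ys zs (x i)
  x∈XYZ i = inj₁ (i , refl)

  x≢v : ∀ i k → x i ≢ v k
  x≢v i k e = v-fresh k (subst (InXYZ x ys zs) e (x∈XYZ i))

  Admissible : PAssign → Set
  Admissible A = Consistent A × (∀ m → memLit m A ≡ true → InXY x ys (var m))

  fresh-unassigned : ∀ A → Admissible A → ∀ w → ¬ InXYZ x ys zs w → ∀ c → memLit (lit w c) A ≡ false
  fresh-unassigned A aok w nw c = ¬-not λ e → nw (subst (InXYZ x ys zs) (var-lit w c) (XY⊆XYZ (proj₂ aok (lit w c) e)))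

  fresh-pos-unassigned : ∀ A → Admissible A → ∀ w → ¬ InXYZ x ys zs w → memLit (pos w) A ≡ false
  fresh-pos-unassigned A aok w nw = fresh-unassigned A aok w nw true

  fresh-neg-unassigned : ∀ A → Admissible A → ∀ w → ¬ InXYZ x ys zs w → memLit (neg w) A ≡ false
  fresh-neg-unassigned A aok w nw = fresh-unassigned A aok w nw false

  otherIndices : Fin n → List (Fin n)
  otherIndices i = filter (λ k → ¬? (k ≟ i)) (L.allFin n)

  otherVs : Fin n → List Lit
  otherVs i = map (λ k → pos (v k)) (otherIndices i)

  memLit-otherVs⁻ : ∀ i q → memLit q (otherVs i) ≡ true → Σ (Fin n) λ k → k ≢ i × q ≡ pos (v k)
  memLit-otherVs⁻ i q e with ∈-map⁻ (λ k → pos (v k)) (memLit→∈ q (otherVs i) e)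
  ... | k , kin , refl = k , proj₂ (∈-filter⁻ (λ k → ¬? (k ≟ i)) {xs = L.allFin n} kin) , refl

  memLit-otherVs⁺ : ∀ i k → k ≢ i → memLit (pos (v k)) (otherVs i) ≡ true
  memLit-otherVs⁺ i k ne = ∈→memLit _ (otherVs i) (∈-map⁺ (λ k → pos (v k)) (∈-filter⁺ (λ k → ¬? (k ≟ i)) (∈-allFin k) ne))

  memLit-otherVs-false : ∀ i q → (∀ k → k ≢ i → q ≡ pos (v k) → ⊥) → memLit q (otherVs i) ≡ false
  memLit-otherVs-false i q h = ¬-not λ e → let (k , k≢i , eq) = memLit-otherVs⁻ i q e in h k k≢i eq

  Unassigned : PAssign → Fin n → Set
  Unassigned A i = ∀ c → memLit (lit (x i) c) A ≡ false

  survives-otherVs : ∀ A i C m → m ∈ C → memLit (compl m) A ≡ false → (∀ k → k ≢ i → compl m ≢ pos (v k)) →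
                     m ∈ shrink (A ++ otherVs i) C
  survives-otherVs A i C m m∈C m-open notOther =
    shrink-mem⁺ (A ++ otherVs i) C m m∈C (memLit-++-false _ A (otherVs i) m-open (memLit-otherVs-false i _ notOther))

  shrink-wide-under-otherVs : ∀ A i → Admissible A → Unassigned A i → ∀ {C} → Shape C →
                              satByI (A ++ otherVs i) C ≡ false → Wide (shrink (A ++ otherVs i) C)
  shrink-wide-under-otherVs A i aok ua (weakShape γ γF) sf = neg a , neg b ,
    survives-otherVs A i (γ ++ neg a ∷ neg b ∷ []) (neg a) (∈-++⁺ʳ γ (here refl)) (fresh-pos-unassigned A aok a a-fresh)
                     (λ k _ e → v≢a k (sym (cong var e))) ,
    survives-otherVs A i (γ ++ neg a ∷ neg b ∷ []) (neg b) (∈-++⁺ʳ γ (there (here refl))) (fresh-pos-unassigned A aok b b-fresh)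
                     (λ k _ e → v≢b k (sym (cong var e))) ,
    (λ e → a≢b (cong var e))
  shrink-wide-under-otherVs A i aok ua (fromAux (xvShape k c)) sf with k ≟ i
  ... | no k≢i with () <- trans (sym sf) (satByI-true⁺ (A ++ otherVs i) (lit (x k) c ∷ pos (v k) ∷ []) (pos (v k)) (there (here refl))
                                            (memLit-++⁺ʳ _ A (otherVs i) (memLit-otherVs⁺ i k k≢i)))
  ... | yes refl = lit (x k) c , pos (v k) ,
    survives-otherVs A k (lit (x k) c ∷ pos (v k) ∷ []) (lit (x k) c) (here refl) (subst (λ l → memLit l A ≡ false) (sym (compl-lit (x k) c)) (ua (not c)))
                     (λ k' _ e → x≢v k k' (trans (sym (var-lit (x k) (not c))) (cong var (trans (sym (compl-lit (x k) c)) e)))) ,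
    survives-otherVs A k (lit (x k) c ∷ pos (v k) ∷ []) (pos (v k)) (there (here refl)) (fresh-neg-unassigned A aok (v k) (v-fresh k)) (λ k' _ ()) ,
    (λ e → x≢v k k (trans (sym (var-lit (x k) c)) (cong var e)))
  shrink-wide-under-otherVs A i aok ua (fromAux aShape) sf = neg (v i) , pos a ,
    survives-otherVs A i clauseA (neg (v i)) (∈-++⁺ˡ (∈-tabulate⁺ i)) (fresh-pos-unassigned A aok (v i) (v-fresh i))
                     (λ k k≢i e → k≢i (sym (v-injective (cong var e)))) ,
    survives-otherVs A i clauseA (pos a) (∈-++⁺ʳ negVs (here refl)) (fresh-neg-unassigned A aok a a-fresh) (λ k _ ()) ,
    (λ ())
  shrink-wide-under-otherVs A i aok ua (fromAux bShape) sf = neg (v i) , pos b ,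
    survives-otherVs A i clauseB (neg (v i)) (∈-++⁺ˡ (∈-tabulate⁺ i)) (fresh-pos-unassigned A aok (v i) (v-fresh i))
                     (λ k k≢i e → k≢i (sym (v-injective (cong var e)))) ,
    survives-otherVs A i clauseB (pos b) (∈-++⁺ʳ negVs (here refl)) (fresh-neg-unassigned A aok b b-fresh) (λ k _ ()) ,
    (λ ())

  wide-under-otherVs : ∀ A i → Admissible A → Unassigned A i → ∀ C' → C' ∈ cXF ∣ (A ++ otherVs i) → Wide C'
  wide-under-otherVs A i aok ua C' mem with restrict-mem⁻ cXF (A ++ otherVs i) C' mem
  ... | C , Cin , sf , refl = shrink-wide-under-otherVs A i aok ua (shape C Cin) sf

  -- A together with all v_k (k ≠ i) leaves only wide clauses, so it is a fixpoint
  -- above every propagation from cXF | A.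
  propagation⊆otherVs : ∀ A i → Admissible A → Unassigned A i → ∀ M → Propagation (cXF ∣ A) M →
                        (M ⊆L otherVs i) × EmptyFree ((cXF ∣ A) ∣ M)
  propagation⊆otherVs A i aok ua M dM =
    propagation-below-fixpoint (cXF ∣ A) M (otherVs i) dM consistent
      (subst UnitFree (sym restrict-eq) (proj₁ fixpoint)) (subst EmptyFree (sym restrict-eq) (proj₂ fixpoint))
    where
      noClash : NoClash A (otherVs i)
      noClash q qK cqA with memLit-otherVs⁻ i q qK
      ... | k , _ , refl with () <- trans (sym cqA) (fresh-neg-unassigned A aok (v k) (v-fresh k))
      consistent : Consistent (otherVs i)
      consistent q e1 e2 with memLit-otherVs⁻ i q e1 | memLit-otherVs⁻ i (compl q) e2
      ... | k , _ , refl | k' , _ , ()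
      restrict-eq : (cXF ∣ A) ∣ otherVs i ≡ cXF ∣ (A ++ otherVs i)
      restrict-eq = restrict-∘ A (otherVs i) cXF noClash
      fixpoint : UnitFree (cXF ∣ (A ++ otherVs i)) × EmptyFree (cXF ∣ (A ++ otherVs i))
      fixpoint = wide-clauses⇒fixpoint (cXF ∣ (A ++ otherVs i)) (wide-under-otherVs A i aok ua)

  unassigned-x-branchable : ∀ A i → Admissible A → Unassigned A i → (¬ Conflict (cXF ∣ A)) × (x i ∈Var U (cXF ∣ A))
  unassigned-x-branchable A i aok ua with U-spec (cXF ∣ A)
  ... | M , dM , _ , eM = (λ c → proj₂ below (conflict⇒[]∈ (cXF ∣ A) M eM c)) , x∈VarU
    where
      below : (M ⊆L otherVs i) × EmptyFree ((cXF ∣ A) ∣ M)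
      below = propagation⊆otherVs A i aok ua M dM
      open-in-M : ∀ q → memLit q (otherVs i) ≡ false → memLit q M ≡ false
      open-in-M = ⊆L-false {M} {otherVs i} (proj₁ below)
      C : Clause
      C = neg (x i) ∷ pos (v i) ∷ []
      ¬xi-open : memLit (neg (x i)) (A ++ M) ≡ false
      ¬xi-open = memLit-++-false _ A M (ua false) (open-in-M _ (memLit-otherVs-false i _ (λ k _ ())))
      vi-open : memLit (pos (v i)) (A ++ M) ≡ false
      vi-open = memLit-++-false _ A M (fresh-pos-unassigned A aok (v i) (v-fresh i))
                  (open-in-M _ (memLit-otherVs-false i _ (λ k k≢i e → k≢i (sym (v-injective (cong var e))))))
      xi-open : memLit (pos (x i)) (A ++ M) ≡ false
      xi-open = memLit-++-false _ A M (ua true) (open-in-M _ (memLit-otherVs-false i _ (λ k _ e → x≢v i k (cong var e))))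
      C-unsatisfied : satByI (A ++ M) C ≡ false
      C-unsatisfied = satByI-false⁺ (A ++ M) C λ { _ (here refl) → ¬xi-open ; _ (there (here refl)) → vi-open }
      x∈VarU : x i ∈Var U (cXF ∣ A)
      x∈VarU = subst (x i ∈Var_) (sym (trans eM (restrict-∘ A M cXF (propagation-noClash cXF A M dM))))
                 (shrink (A ++ M) C , restrict-mem⁺ cXF (A ++ M) C (xvPair∈cXF i false) C-unsatisfied ,
                  inj₂ (shrink-mem⁺ (A ++ M) C _ (here refl) xi-open))

  AllAssigned : PAssign → Set
  AllAssigned A = ∀ i → Σ Bool λ c → memLit (lit (x i) c) A ≡ true

  FreshPositive : List Lit → Set
  FreshPositive R = ∀ q → memLit q R ≡ true → Σ ℕ λ w → (q ≡ pos w) × ¬ InXYZ x ys zs w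

  freshPositive-neg : ∀ R → FreshPositive R → ∀ w → memLit (neg w) R ≡ false
  freshPositive-neg R fp w with memLit (neg w) R in e
  ... | false = refl
  ... | true with fp (neg w) e
  ... | _ , () , _

  freshPositive-XYZ : ∀ R → FreshPositive R → ∀ q → InXYZ x ys zs (var q) → memLit q R ≡ false
  freshPositive-XYZ R fp q h = ¬-not λ m → let (w , eq , nw) = fp q m in nw (subst (InXYZ x ys zs) (cong var eq) h)

  freshPositive-noClash : ∀ A R → Admissible A → FreshPositive R → NoClash A R
  freshPositive-noClash A R aok fp q qR cqA with fp q qR
  ... | w , refl , nw with () <- trans (sym cqA) (fresh-neg-unassigned A aok w nw)

  freshPositive-∷ : ∀ R t → FreshPositive R → ¬ InXYZ x ys zs t → FreshPositive (pos t ∷ R)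
  freshPositive-∷ R t fp nt q e with ∨-≡true⁻ (litEq q (pos t)) (memLit q R) e
  ... | inj₁ h = t , litEq-sound q (pos t) h , nt
  ... | inj₂ h = fp q h

  vsOf : ∀ {k} → (Fin k → Fin n) → List Lit
  vsOf e = L.tabulate (λ j → pos (v (e j)))

  freshPositive-vsOf : ∀ {k} (e : Fin k → Fin n) → FreshPositive (vsOf e)
  freshPositive-vsOf e q m = let (j , eq) = memLit-tabulate⁻ (λ j → pos (v (e j))) q m in v (e j) , eq , v-fresh (e j)

  allVs : List Lit
  allVs = vsOf (λ j → j)

  negVs-unit : ∀ J t → (∀ k → memLit (neg (v k)) J ≡ false) → (∀ k → memLit (pos (v k)) J ≡ true) →
             memLit (pos t) J ≡ false → memLit (neg t) J ≡ false →
             (satByI J (negVs ++ (pos t ∷ [])) ≡ false) × (shrink J (negVs ++ (pos t ∷ [])) ≡ pos t ∷ [])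
  negVs-unit J t h1 h2 h3 h4 = satByI-false⁺ J _ f , sh
    where
      f : ∀ m → m ∈ negVs ++ (pos t ∷ []) → memLit m J ≡ false
      f m p with ∈-++⁻ negVs p
      ... | inj₂ (here refl) = h3
      ... | inj₁ q with ∈-tabulate⁻ {f = λ i → neg (v i)} q
      ... | k , refl = h1 k
      sh : shrink J (negVs ++ (pos t ∷ [])) ≡ pos t ∷ []
      sh rewrite shrink-++ J negVs (pos t ∷ []) | h4
         | shrink-all J negVs (λ m p → let (k , e) = ∈-tabulate⁻ {f = λ i → neg (v i)} p in
                                       subst (λ z → memLit (compl z) J ≡ true) (sym e) (h2 k)) = refl

  module _ (A : PAssign) (aok : Admissible A) (all : AllAssigned A) where

    propagate-vsOf : ∀ k (e : Fin k → Fin n) → (∀ {i j} → e i ≡ e j → i ≡ j) → Propagation (cXF ∣ A) (vsOf e)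
    propagate-vsOf zero e inj = none
    propagate-vsOf (suc k) e inj = step unit (propagate-vsOf k e' (λ eq → Fin.suc-injective (inj eq)))
      where
        e' : Fin k → Fin n
        e' j = e (suc j)
        i : Fin n
        i = e zero
        c : Bool
        c = proj₁ (all i)
        M' : List Lit
        M' = vsOf e'
        fp : FreshPositive M'
        fp = freshPositive-vsOf e'
        C : Clause
        C = lit (x i) (not c) ∷ pos (v i) ∷ []
        x-fixed : memLit (compl (lit (x i) (not c))) A ≡ true
        x-fixed rewrite compl-lit (x i) (not c) | not-involutive c = proj₂ (all i)
        x-open : memLit (lit (x i) (not c)) (A ++ M') ≡ false
        x-open = memLit-++-false _ A M' (¬-not λ m → proj₁ aok _ m x-fixed)
                   (freshPositive-XYZ M' fp _ (subst (InXYZ x ys zs) (sym (var-lit (x i) (not c))) (x∈XYZ i)))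
        vi-open : memLit (pos (v i)) (A ++ M') ≡ false
        vi-open = memLit-++-false _ A M' (fresh-pos-unassigned A aok (v i) (v-fresh i))
                    (¬-not λ m → let (j , eq) = memLit-tabulate⁻ (λ j → pos (v (e' j))) _ m in 0≢1+n (inj (v-injective (cong var eq))))
        unassigned : satByI (A ++ M') C ≡ false
        unassigned = satByI-false⁺ (A ++ M') C λ { _ (here refl) → x-open ; _ (there (here refl)) → vi-open }
        unit-shape : shrink (A ++ M') C ≡ pos (v i) ∷ []
        unit-shape rewrite memLit-++⁺ˡ (compl (lit (x i) (not c))) A M' x-fixed
                         | memLit-++-false _ A M' (fresh-neg-unassigned A aok (v i) (v-fresh i)) (freshPositive-neg M' fp (v i)) = refl
        unit : (pos (v i) ∷ []) ∈ (cXF ∣ A) ∣ M'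
        unit = subst ((pos (v i) ∷ []) ∈_) (sym (restrict-∘ A M' cXF (freshPositive-noClash A M' aok fp)))
                 (subst (_∈ cXF ∣ (A ++ M')) unit-shape (restrict-mem⁺ cXF (A ++ M') C (xvPair∈cXF i (not c)) unassigned))

    ab-unit : ∀ R t → FreshPositive R → (∀ k → memLit (pos (v k)) R ≡ true) → negVs ++ (pos t ∷ []) ∈ cXF →
              memLit (pos t) R ≡ false → ¬ InXYZ x ys zs t → (pos t ∷ []) ∈ (cXF ∣ A) ∣ R
    ab-unit R t fp vs∈R clause∈ pt nt = subst ((pos t ∷ []) ∈_) (sym (restrict-∘ A R cXF (freshPositive-noClash A R aok fp)))
        (subst (_∈ cXF ∣ (A ++ R)) (proj₂ lu) (restrict-mem⁺ cXF (A ++ R) _ clause∈ (proj₁ lu)))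
      where
        neg-open : ∀ w → ¬ InXYZ x ys zs w → memLit (neg w) (A ++ R) ≡ false
        neg-open w nw = memLit-++-false _ A R (fresh-neg-unassigned A aok w nw) (freshPositive-neg R fp w)
        lu : (satByI (A ++ R) (negVs ++ (pos t ∷ [])) ≡ false) × (shrink (A ++ R) (negVs ++ (pos t ∷ [])) ≡ pos t ∷ [])
        lu = negVs-unit (A ++ R) t (λ k → neg-open (v k) (v-fresh k)) (λ k → memLit-++⁺ʳ _ A R (vs∈R k))
               (memLit-++-false _ A R (fresh-pos-unassigned A aok t nt) pt) (neg-open t nt)

    -- With X fully assigned, the pair clauses force every v_k, then the two long
    -- clauses force a and b.
    forcedLits : List Lit
    forcedLits = pos b ∷ pos a ∷ allVs

    freshPositive-forcedLits : FreshPositive forcedLits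
    freshPositive-forcedLits = freshPositive-∷ (pos a ∷ allVs) b (freshPositive-∷ allVs a (freshPositive-vsOf (λ j → j)) a-fresh) b-fresh

    propagate-forcedLits : Propagation (cXF ∣ A) forcedLits
    propagate-forcedLits =
      step (ab-unit (pos a ∷ allVs) b (freshPositive-∷ allVs a (freshPositive-vsOf (λ j → j)) a-fresh)
                    (λ k → memLit-there _ (pos a) allVs (memLit-tabulate⁺ (λ j → pos (v j)) k)) clauseB∈cXF b-new b-fresh)
      (step (ab-unit allVs a (freshPositive-vsOf (λ j → j)) (memLit-tabulate⁺ (λ j → pos (v j))) clauseA∈cXF a-new a-fresh)
            (propagate-vsOf n (λ j → j) (λ e → e)))
      where
        a-new : memLit (pos a) allVs ≡ false
        a-new = ¬-not λ m → let (j , eq) = memLit-tabulate⁻ (λ j → pos (v j)) _ m in v≢a j (sym (cong var eq))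
        b-new : memLit (pos b) (pos a ∷ allVs) ≡ false
        b-new = ¬-not λ m → [ (λ h → a≢b (sym (cong var (litEq-sound (pos b) (pos a) h))))
                             , (λ h → let (j , eq) = memLit-tabulate⁻ (λ j → pos (v j)) _ h in v≢b j (sym (cong var eq))) ]′
                             (∨-≡true⁻ (litEq (pos b) (pos a)) (memLit (pos b) allVs) m)

    JI : PAssign
    JI = A ++ forcedLits

    forced⁺ : ∀ q → memLit q forcedLits ≡ true → memLit q JI ≡ true
    forced⁺ q = memLit-++⁺ʳ q A forcedLits

    fresh-neg-open : ∀ w → ¬ InXYZ x ys zs w → memLit (neg w) JI ≡ false
    fresh-neg-open w nw = memLit-++-false _ A forcedLits (fresh-neg-unassigned A aok w nw) (freshPositive-neg forcedLits freshPositive-forcedLits w)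

    auxClauses-satisfied : auxClauses ∣ JI ≡ []
    auxClauses-satisfied = restrict-all-satisfied auxClauses JI satisfied
      where
        v∈forced : ∀ i → memLit (pos (v i)) forcedLits ≡ true
        v∈forced i = memLit-there (pos (v i)) (pos b) (pos a ∷ allVs) (memLit-there (pos (v i)) (pos a) allVs (memLit-tabulate⁺ (λ j → pos (v j)) i))
        satisfied : ∀ C → C ∈ auxClauses → satByI JI C ≡ true
        satisfied C p with auxShape C p
        ... | xvShape i c = satByI-true⁺ JI (lit (x i) c ∷ pos (v i) ∷ []) (pos (v i)) (there (here refl)) (forced⁺ _ (v∈forced i))
        ... | aShape = satByI-true⁺ JI clauseA (pos a) (∈-++⁺ʳ negVs (here refl)) (forced⁺ _ (∈→memLit _ forcedLits (there (here refl))))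
        ... | bShape = satByI-true⁺ JI clauseB (pos b) (∈-++⁺ʳ negVs (here refl)) (forced⁺ _ (∈→memLit _ forcedLits (here refl)))

    memLit-forced-XYZ : ∀ m → InXYZ x ys zs (var m) → memLit m JI ≡ memLit m A
    memLit-forced-XYZ m hm rewrite memLit-++ m A forcedLits | freshPositive-XYZ forcedLits freshPositive-forcedLits m hm = ∨-identityʳ _

    satByI-weakened : ∀ γ → γ ∈ F → satByI JI (γ ++ (neg a ∷ neg b ∷ [])) ≡ satByI A γ
    satByI-weakened γ γF rewrite satByI-++ JI γ (neg a ∷ neg b ∷ []) | fresh-neg-open a a-fresh | fresh-neg-open b b-fresh
                               | ∨-identityʳ (satByI JI γ) =
      satByI-cong JI A γ (λ m p → memLit-forced-XYZ m (F-var γ m γF p))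

    shrink-weakened : ∀ γ → γ ∈ F → shrink JI (γ ++ (neg a ∷ neg b ∷ [])) ≡ shrink A γ
    shrink-weakened γ γF rewrite shrink-++ JI γ (neg a ∷ neg b ∷ [])
                               | forced⁺ (pos a) (∈→memLit _ forcedLits (there (here refl)))
                               | forced⁺ (pos b) (∈→memLit _ forcedLits (here refl))
                               | ++-identityʳ (shrink JI γ) =
      shrink-cong JI A γ (λ m p → memLit-forced-XYZ (compl m) (subst (InXYZ x ys zs) (sym (var-compl m)) (F-var γ m γF p)))

    restrict-weakened : ∀ G → (∀ γ → γ ∈ G → γ ∈ F) → (map (λ γ → γ ++ (neg a ∷ neg b ∷ [])) G) ∣ JI ≡ G ∣ A
    restrict-weakened [] h = refl
    restrict-weakened (γ ∷ G) h rewrite satByI-weakened γ (h γ (here refl)) | shrink-weakened γ (h γ (here refl))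
                                      | restrict-weakened G (λ γ' p → h γ' (there p)) = refl

    assigned≈UP-F : (cXF ∣ A) ≈UP (F ∣ A)
    assigned≈UP-F = ≈UP-trans (restrict-propagation (cXF ∣ A) forcedLits propagate-forcedLits)
           (≈UP-reflexive (trans (restrict-∘ A forcedLits cXF (freshPositive-noClash A forcedLits aok freshPositive-forcedLits))
                (trans (restrict-++ weakenedF auxClauses JI)
                (trans (cong₂ _++_ (restrict-weakened F (λ γ p → p)) auxClauses-satisfied) (++-identityʳ (F ∣ A))))))

  disagrees : Vec Bool n → PAssign → Fin n → Bool
  disagrees X' A i = memLit (lit (x i) (not (lookup X' i))) A

  agrees : Vec Bool n → PAssign → Bool
  agrees X' A = not (any (disagrees X' A) (L.allFin n))

  agrees⁻ : ∀ X' A → agrees X' A ≡ true → ∀ i → disagrees X' A i ≡ false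
  agrees⁻ X' A e i with any (disagrees X' A) (L.allFin n) in e'
  agrees⁻ X' A refl i | false = any-false⁻ (disagrees X' A) (L.allFin n) i e' (∈-allFin i)

  agrees⁺ : ∀ X' A → (∀ i → disagrees X' A i ≡ false) → agrees X' A ≡ true
  agrees⁺ X' A h rewrite any-false⁺ (disagrees X' A) (L.allFin n) h = refl

  agrees-[] : ∀ X' → agrees X' [] ≡ true
  agrees-[] X' = agrees⁺ X' [] (λ i → refl)

  agrees-∷-nonX : ∀ X' A l → (∀ i c → lit (x i) c ≡ l → ⊥) → agrees X' (l ∷ A) ≡ agrees X' A
  agrees-∷-nonX X' A l h with agrees X' A in e
  ... | true = agrees⁺ X' (l ∷ A) f
    where
      f : ∀ i → disagrees X' (l ∷ A) i ≡ false
      f i with litEq (lit (x i) (not (lookup X' i))) l in e'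
      ... | true = ⊥-elim (h i (not (lookup X' i)) (litEq-sound _ _ e'))
      ... | false = agrees⁻ X' A e i
  ... | false = ¬-not {agrees X' (l ∷ A)} λ c → false≢true (trans (sym e) (agrees⁺ X' A (λ i →
        ∨-conicalʳ (litEq (lit (x i) (not (lookup X' i))) l) _ (agrees⁻ X' (l ∷ A) c i))))

  agrees-∷-x⁻ : ∀ X' A i c → agrees X' (lit (x i) c ∷ A) ≡ true → (agrees X' A ≡ true) × (lookup X' i ≡ c)
  agrees-∷-x⁻ X' A i c e = agrees⁺ X' A (λ j → ∨-conicalʳ _ _ (agrees⁻ X' (lit (x i) c ∷ A) e j)) , lk (lookup X' i) c refl
      (∨-conicalˡ _ _ (agrees⁻ X' (lit (x i) c ∷ A) e i))
    where
      lk : ∀ d c → lookup X' i ≡ d → litEq (lit (x i) (not d)) (lit (x i) c) ≡ false → d ≡ c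
      lk true true _ _ = refl
      lk false false _ _ = refl
      lk true false _ h with () <- trans (sym h) (litEq-refl (neg (x i)))
      lk false true _ h with () <- trans (sym h) (litEq-refl (pos (x i)))

  agrees-∷-x⁺ : ∀ X' A i c → agrees X' A ≡ true → lookup X' i ≡ c → agrees X' (lit (x i) c ∷ A) ≡ true
  agrees-∷-x⁺ X' A i c e ec = agrees⁺ X' (lit (x i) c ∷ A) f
    where
      f : ∀ j → disagrees X' (lit (x i) c ∷ A) j ≡ false
      f j with litEq (lit (x j) (not (lookup X' j))) (lit (x i) c) in e'
      ... | false = agrees⁻ X' A e j
      ... | true with lit-injective (x j) (x i) (not (lookup X' j)) c (litEq-sound _ _ e')
      ... | p , q with x-injective {j} {i} p
      ... | refl rewrite ec = ⊥-elim (not-¬ refl (sym q))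

  xValues : ∀ A → AllAssigned A → Vec Bool n
  xValues A all = tabulate (λ i → proj₁ (all i))

  agrees⇒≡xValues : ∀ X' A → (all : AllAssigned A) → agrees X' A ≡ true → X' ≡ xValues A all
  agrees⇒≡xValues X' A all e = trans (sym (tabulate∘lookup X')) (tabulate-cong pt)
    where
      pt : ∀ i → lookup X' i ≡ proj₁ (all i)
      pt i = aux (lookup X' i) (proj₁ (all i)) (proj₂ (all i)) (agrees⁻ X' A e i)
        where
          aux : ∀ d c → memLit (lit (x i) c) A ≡ true → memLit (lit (x i) (not d)) A ≡ false → d ≡ c
          aux true true _ _ = refl
          aux false false _ _ = refl
          aux true false h h' with () <- trans (sym h) h'
          aux false true h h' with () <- trans (sym h) h'

  agrees-xValues : ∀ A → Admissible A → (all : AllAssigned A) → agrees (xValues A all) A ≡ true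
  agrees-xValues A aok all = agrees⁺ (xValues A all) A f
    where
      f : ∀ i → disagrees (xValues A all) A i ≡ false
      f i rewrite lookup∘tabulate (λ i → proj₁ (all i)) i with memLit (lit (x i) (not (proj₁ (all i)))) A in e
      ... | false = refl
      ... | true = ⊥-elim (proj₁ aok _ (proj₂ (all i)) (subst (λ z → memLit z A ≡ true)
                     (sym (compl-lit (x i) (proj₁ (all i)))) e))

  memLit-assignX⁻ : ∀ X' q → memLit q (assignX x X') ≡ true → Σ (Fin n) λ i → q ≡ lit (x i) (lookup X' i)
  memLit-assignX⁻ X' q e = memLit-tabulate⁻ (λ i → lit (x i) (lookup X' i)) q e

  memLit-assignX⁺ : ∀ X' i → memLit (lit (x i) (lookup X' i)) (assignX x X') ≡ true
  memLit-assignX⁺ X' i = memLit-tabulate⁺ (λ i → lit (x i) (lookup X' i)) i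

  restrict-F-assigned : ∀ X' A → (all : AllAssigned A) → agrees X' A ≡ true → F ∣ (assignX x X' ++ A) ≡ F ∣ A
  restrict-F-assigned X' A all cp = restrict-cong (assignX x X' ++ A) A F (memLit-++-⊆L (assignX x X') A sub)
    where
      sub : assignX x X' ⊆L A
      sub q e with memLit-assignX⁻ X' q e
      ... | i , refl rewrite trans (cong (λ z → lookup z i) (agrees⇒≡xValues X' A all cp)) (lookup∘tabulate (λ i → proj₁ (all i)) i) = proj₂ (all i)

  memLit-insert-redundant : ∀ Q A l → memLit l Q ≡ true → ∀ m → memLit m (Q ++ (l ∷ A)) ≡ memLit m (Q ++ A)
  memLit-insert-redundant Q A l el m rewrite memLit-++ m Q (l ∷ A) | memLit-++ m Q A with memLit m Q in e
  ... | true = refl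
  ... | false with litEq m l in e'
  ... | false = refl
  ... | true rewrite litEq-sound m l e' with () <- trans (sym e) el

  restrict-F-x : ∀ X' A i c → lookup X' i ≡ c → F ∣ (assignX x X' ++ (lit (x i) c ∷ A)) ≡ F ∣ (assignX x X' ++ A)
  restrict-F-x X' A i c ec = restrict-cong _ _ F (memLit-insert-redundant (assignX x X') A (lit (x i) c)
    (subst (λ z → memLit (lit (x i) z) (assignX x X') ≡ true) ec (memLit-assignX⁺ X' i)))

  ∨-shuffle : ∀ p q e → ((p ∨ q) ∨ (e ∨ false)) ≡ (p ∨ (e ∨ q))
  ∨-shuffle true q e = refl
  ∨-shuffle false true true = refl
  ∨-shuffle false true false = refl
  ∨-shuffle false false true = refl
  ∨-shuffle false false false = refl

  restrict-F-∷ : ∀ X' A l → NoClash (assignX x X' ++ A) (l ∷ []) → (F ∣ (assignX x X' ++ A)) ∣ (l ∷ []) ≡ F ∣ (assignX x X' ++ (l ∷ A))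
  restrict-F-∷ X' A l d = trans (restrict-∘ (assignX x X' ++ A) (l ∷ []) F d) (restrict-cong _ _ F pw)
    where
      pw : ∀ m → memLit m ((assignX x X' ++ A) ++ (l ∷ [])) ≡ memLit m (assignX x X' ++ (l ∷ A))
      pw m rewrite memLit-++ m (assignX x X' ++ A) (l ∷ []) | memLit-++ m (assignX x X') A | memLit-++ m (assignX x X') (l ∷ A) =
        ∨-shuffle (memLit m (assignX x X')) (memLit m A) (litEq m l)

  -- At the root this is 2^n + Σ |g X'| (weight-[]); a node of c_X(F) splits it between its children.
  weight : PAssign → (Vec Bool n → Tree) → ℕ
  weight A g = sumVec (λ X' → if agrees X' A then suc (size (g X')) else 0)

  weight-split : ∀ A j g g1 g2 → (∀ X' → lookup X' j ≡ false → size (g X') ≡ size (g1 X')) →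
           (∀ X' → lookup X' j ≡ true → size (g X') ≡ size (g2 X')) →
           weight A g ≡ weight (lit (x j) false ∷ A) g1 + weight (lit (x j) true ∷ A) g2
  weight-split A j g g1 g2 h1 h2 = trans (sum-map-cong (allVec n) _ _ pw) (sum-map-+ (allVec n) _ _)
    where
      pw : ∀ X' → (if agrees X' A then suc (size (g X')) else 0) ≡
                  (if agrees X' (lit (x j) false ∷ A) then suc (size (g1 X')) else 0) +
                  (if agrees X' (lit (x j) true ∷ A) then suc (size (g2 X')) else 0)
      pw X' with agrees X' A in agreeA
      ... | false rewrite ¬-not {agrees X' (lit (x j) false ∷ A)} (λ c → false≢true (trans (sym agreeA) (proj₁ (agrees-∷-x⁻ X' A j false c))))
                        | ¬-not {agrees X' (lit (x j) true ∷ A)} (λ c → false≢true (trans (sym agreeA) (proj₁ (agrees-∷-x⁻ X' A j true c)))) = refl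
      ... | true with lookup X' j in ej
      ... | true rewrite agrees-∷-x⁺ X' A j true agreeA ej
                       | ¬-not {agrees X' (lit (x j) false ∷ A)} (λ c → not-¬ refl (trans (sym ej) (proj₂ (agrees-∷-x⁻ X' A j false c)))) = cong suc (h2 X' ej)
      ... | false rewrite agrees-∷-x⁺ X' A j false agreeA ej
                       | ¬-not {agrees X' (lit (x j) true ∷ A)} (λ c → not-¬ refl (trans (sym ej) (proj₂ (agrees-∷-x⁻ X' A j true c)))) =
                         trans (cong suc (h1 X' ej)) (sym (+-identityʳ _))

  weight-bound : ∀ A l1 l2 g g1 g2 → (∀ X' → agrees X' (l1 ∷ A) ≡ agrees X' A) → (∀ X' → agrees X' (l2 ∷ A) ≡ agrees X' A) →
           (∀ X' → agrees X' A ≡ true → size (g X') ≤ suc (size (g1 X') + size (g2 X'))) →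
           weight A g ≤ weight (l1 ∷ A) g1 + weight (l2 ∷ A) g2
  weight-bound A l1 l2 g g1 g2 c1 c2 hb = ≤-trans (sum-map-mono (allVec n) _ _ pw) (≤-reflexive (sum-map-+ (allVec n) _ _))
    where
      pw : ∀ X' → (if agrees X' A then suc (size (g X')) else 0) ≤
                  (if agrees X' (l1 ∷ A) then suc (size (g1 X')) else 0) +
                  (if agrees X' (l2 ∷ A) then suc (size (g2 X')) else 0)
      pw X' rewrite c1 X' | c2 X' with agrees X' A in agreeA
      ... | false = z≤n
      ... | true = s≤s (subst (size (g X') ≤_) (sym (+-suc (size (g1 X')) (size (g2 X')))) (hb X' agreeA))

  allAssigned? : ∀ A → AllAssigned A ⊎ Σ (Fin n) (Unassigned A)
  allAssigned? A with scan (L.allFin n)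
    where
      scan : ∀ ks → (∀ i → i ∈ ks → Σ Bool λ c → memLit (lit (x i) c) A ≡ true) ⊎ Σ (Fin n) (Unassigned A)
      scan [] = inj₁ (λ i ())
      scan (i ∷ ks) with memLit (lit (x i) true) A in e1 | memLit (lit (x i) false) A in e2
      ... | false | false = inj₂ (i , λ { true → e1 ; false → e2 })
      ... | true | _ with scan ks
      ...   | inj₁ h = inj₁ (λ { j (here refl) → true , e1 ; j (there p) → h j p })
      ...   | inj₂ u = inj₂ u
      scan (i ∷ ks) | false | true with scan ks
      ...   | inj₁ h = inj₁ (λ { j (here refl) → false , e2 ; j (there p) → h j p })
      ...   | inj₂ u = inj₂ u
  ... | inj₁ h = inj₁ (λ i → h i (∈-allFin i))
  ... | inj₂ u = inj₂ u

  admissible-∷ : ∀ A w c → Admissible A → InXY x ys w → memLit (pos w) A ≡ false → memLit (neg w) A ≡ false → Admissible (lit w c ∷ A)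
  admissible-∷ A w c aok bw e1 e2 = cns , vr
    where
      l : Lit
      l = lit w c
      cl : memLit (compl l) A ≡ false
      cl rewrite compl-lit w c = memLit-lit-false A w (e1 , e2) (not c)
      cns : Consistent (l ∷ A)
      cns q h1 h2 with ∨-≡true⁻ (litEq q l) (memLit q A) h1 | ∨-≡true⁻ (litEq (compl q) l) (memLit (compl q) A) h2
      ... | inj₁ a' | inj₁ b' rewrite litEq-sound q l a' = compl-≢ l (litEq-sound _ _ b')
      ... | inj₁ a' | inj₂ b' rewrite litEq-sound q l a' with () <- trans (sym b') cl
      ... | inj₂ a' | inj₁ b' with litEq-sound (compl q) l b'
      ... | eq with () <- trans (sym (subst (λ z → memLit z A ≡ true) (trans (sym (compl-involutive q)) (cong compl eq)) a')) cl
      cns q h1 h2 | inj₂ a' | inj₂ b' = proj₁ aok q a' b'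
      vr : ∀ m → memLit m (l ∷ A) ≡ true → InXY x ys (var m)
      vr m h with ∨-≡true⁻ (litEq m l) (memLit m A) h
      ... | inj₁ a' rewrite litEq-sound m l a' | var-lit w c = bw
      ... | inj₂ a' = proj₂ aok m a'

  Simulation : Tree → PAssign → Set
  Simulation T A = Σ (Vec Bool n → Tree) λ g →
    (∀ X' → agrees X' A ≡ true → DMST Branch (F ∣ (assignX x X' ++ A)) (g X')) × (weight A g ≤ suc (size T))

  weight-assigned : ∀ A → Admissible A → (all : AllAssigned A) → ∀ g → weight A g ≡ suc (size (g (xValues A all)))
  weight-assigned A aok all g = trans (sumVec-single n _ (xValues A all) vanish)
                                      (cong (λ b → if b then suc (size (g (xValues A all))) else 0) (agrees-xValues A aok all))
    where
      vanish : ∀ X' → X' ≢ xValues A all → (if agrees X' A then suc (size (g X')) else 0) ≡ 0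
      vanish X' ne with agrees X' A in agree
      ... | true = ⊥-elim (ne (agrees⇒≡xValues X' A all agree))
      ... | false = refl

  simulate-assigned : ∀ T A → Admissible A → AllAssigned A → DMST Branch (cXF ∣ A) T → Simulation T A
  simulate-assigned T A aok all d = (λ _ → T) , simulated , ≤-reflexive (weight-assigned A aok all (λ _ → T))
    where
      simulated : ∀ X' → agrees X' A ≡ true → DMST Branch (F ∣ (assignX x X' ++ A)) T
      simulated X' agree = subst (λ G → DMST Branch G T) (sym (restrict-F-assigned X' A all agree)) (DMST-≈UP d (assigned≈UP-F A aok all))

  simulate-x : ∀ j T1 T2 A → Simulation T1 (lit (x j) false ∷ A) → Simulation T2 (lit (x j) true ∷ A) →
               Simulation (node (x j) T1 T2) A
  simulate-x j T1 T2 A (g1 , gD1 , b1) (g2 , gD2 , b2) = g , gD , bound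
    where
      g : Vec Bool n → Tree
      g X' = if lookup X' j then g2 X' else g1 X'
      gD : ∀ X' → agrees X' A ≡ true → DMST Branch (F ∣ (assignX x X' ++ A)) (g X')
      gD X' agree with lookup X' j in ej
      ... | true = subst (λ G → DMST Branch G (g2 X')) (restrict-F-x X' A j true ej) (gD2 X' (agrees-∷-x⁺ X' A j true agree ej))
      ... | false = subst (λ G → DMST Branch G (g1 X')) (restrict-F-x X' A j false ej) (gD1 X' (agrees-∷-x⁺ X' A j false agree ej))
      g≡g1 : ∀ X' → lookup X' j ≡ false → size (g X') ≡ size (g1 X')
      g≡g1 X' e rewrite e = refl
      g≡g2 : ∀ X' → lookup X' j ≡ true → size (g X') ≡ size (g2 X')
      g≡g2 X' e rewrite e = refl
      bound : weight A g ≤ suc (size (node (x j) T1 T2))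
      bound rewrite weight-split A j g g1 g2 g≡g1 g≡g2 =
        subst (weight (lit (x j) false ∷ A) g1 + weight (lit (x j) true ∷ A) g2 ≤_) (cong suc (+-suc (size T1) (size T2))) (+-mono-≤ b1 b2)

  simulate-y : ∀ w T1 T2 A → w ∈ ys → w ∈Var U (cXF ∣ A) →
               Simulation T1 (lit w false ∷ A) → Simulation T2 (lit w true ∷ A) → Simulation (node w T1 T2) A
  simulate-y w T1 T2 A w∈ys wv (g1 , gD1 , b1) (g2 , gD2 , b2) = g , gD , bound
    where
      not-x : ∀ i c c' → lit (x i) c ≡ lit w c' → ⊥
      not-x i c c' e = x∉ys i (subst (_∈ ys) (sym (proj₁ (lit-injective _ _ _ _ e))) w∈ys)
      agrees-w : ∀ c X' → agrees X' (lit w c ∷ A) ≡ agrees X' A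
      agrees-w c X' = agrees-∷-nonX X' A (lit w c) (λ i c' e → not-x i c' c e)
      noClash : ∀ X' c → NoClash (assignX x X' ++ A) (lit w c ∷ [])
      noClash X' c q ql cq with ∨-≡true⁻ (litEq q (lit w c)) false ql
      ... | inj₁ h rewrite litEq-sound q (lit w c) h | compl-lit w c with ∨-≡true⁻ _ _ (trans (sym (memLit-++ _ (assignX x X') A)) cq)
      ... | inj₂ h' with () <- trans (sym h') (memLit-lit-false A w (∈Var-U-restrict-unassigned cXF A w wv) (not c))
      ... | inj₁ h' with memLit-assignX⁻ X' _ h'
      ... | i , e = not-x i _ _ (sym e)
      child : ∀ c (g' : Vec Bool n → Tree) → (∀ X' → agrees X' (lit w c ∷ A) ≡ true → DMST Branch (F ∣ (assignX x X' ++ (lit w c ∷ A))) (g' X')) →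
              ∀ X' → agrees X' A ≡ true → DMST Branch ((F ∣ (assignX x X' ++ A)) ∣ (lit w c ∷ [])) (g' X')
      child c g' gD' X' agree = subst (λ G → DMST Branch G (g' X')) (sym (restrict-F-∷ X' A (lit w c) (noClash X' c))) (gD' X' (trans (agrees-w c X') agree))
      realised : ∀ X' → Realisation Branch (F ∣ (assignX x X' ++ A)) w (g1 X') (g2 X')
      realised X' = branch-realisable (F ∣ (assignX x X' ++ A)) w (inj₂ w∈ys) (g1 X') (g2 X')
      g : Vec Bool n → Tree
      g X' = proj₁ (realised X')
      gD : ∀ X' → agrees X' A ≡ true → DMST Branch (F ∣ (assignX x X' ++ A)) (g X')
      gD X' agree = proj₁ (proj₂ (realised X')) (child false g1 gD1 X' agree) (child true g2 gD2 X' agree)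
      bound : weight A g ≤ suc (size (node w T1 T2))
      bound = ≤-trans (weight-bound A (lit w false) (lit w true) g g1 g2 (agrees-w false) (agrees-w true) (λ X' _ → proj₂ (proj₂ (realised X'))))
        (subst (weight (lit w false ∷ A) g1 + weight (lit w true ∷ A) g2 ≤_) (cong suc (+-suc (size T1) (size T2))) (+-mono-≤ b1 b2))

  simulate : ∀ T A → Admissible A → DMST Branch (cXF ∣ A) T → Simulation T A
  simulate T A aok d with allAssigned? A
  simulate T A aok d | inj₁ all = simulate-assigned T A aok all d
  simulate leaf A aok (dleaf c) | inj₂ (i , ua) = ⊥-elim (proj₁ (unassigned-x-branchable A i aok ua) c)
  simulate (node w T1 T2) A aok (dnode nc wv bw d1 d2) | inj₂ (i , ua) =
    simulate-branch bw
      (simulate T1 (lit w false ∷ A) (aok' false) (DMST-≈UP d1 (branch≈UP cXF A w false wv)))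
      (simulate T2 (lit w true ∷ A) (aok' true) (DMST-≈UP d2 (branch≈UP cXF A w true wv)))
    where
      simulate-branch : Branch w → Simulation T1 (lit w false ∷ A) → Simulation T2 (lit w true ∷ A) → Simulation (node w T1 T2) A
      simulate-branch (inj₁ (j , refl)) = simulate-x j T1 T2 A
      simulate-branch (inj₂ w∈ys) = simulate-y w T1 T2 A w∈ys wv
      uw : (memLit (pos w) A ≡ false) × (memLit (neg w) A ≡ false)
      uw = ∈Var-U-restrict-unassigned cXF A w wv
      aok' : ∀ c → Admissible (lit w c ∷ A)
      aok' c = admissible-∷ A w c aok bw (proj₁ uw) (proj₂ uw)

  AssignedOutside : List (Fin n) → PAssign → Set
  AssignedOutside ks A = ∀ i → i ∉ ks → Σ Bool λ c → memLit (lit (x i) c) A ≡ true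

  assignedOutside-∷ : ∀ ks A i c → AssignedOutside (i ∷ ks) A → memLit (lit (x i) c) A ≡ true → AssignedOutside ks A
  assignedOutside-∷ ks A i c h e j j∉ks with j ≟ i
  ... | yes refl = c , e
  ... | no j≢i = h j (λ { (here eq) → j≢i eq ; (there p) → j∉ks p })

  assignedOutside-extend : ∀ ks A i c → AssignedOutside (i ∷ ks) A → AssignedOutside ks (lit (x i) c ∷ A)
  assignedOutside-extend ks A i c h j j∉ks with j ≟ i
  ... | yes refl = c , memLit-head (lit (x i) c) A
  ... | no j≢i = let (c' , e) = h j (λ { (here eq) → j≢i eq ; (there p) → j∉ks p }) in c' , memLit-there _ _ A e

  Built : PAssign → (Vec Bool n → Tree) → Set
  Built A g = Σ Tree λ T → DMST Branch (cXF ∣ A) T × (suc (size T) ≡ weight A g)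

  build-assigned : ∀ A g → Admissible A → AllAssigned A →
                   (∀ X' → agrees X' A ≡ true → DMST Branch (F ∣ (assignX x X' ++ A)) (g X')) → Built A g
  build-assigned A g aok all gD =
    g X₀ , DMST-≈UP (subst (λ G → DMST Branch G (g X₀)) (restrict-F-assigned X₀ A all agree) (gD X₀ agree)) (≈UP-sym (assigned≈UP-F A aok all)) ,
    sym (weight-assigned A aok all g)
    where
      X₀ : Vec Bool n
      X₀ = xValues A all
      agree : agrees X₀ A ≡ true
      agree = agrees-xValues A aok all

  build-x : ∀ A i g → Admissible A → Unassigned A i → Built (lit (x i) false ∷ A) g → Built (lit (x i) true ∷ A) g → Built A g
  build-x A i g aok ua (T1 , D1 , eq1) (T2 , D2 , eq2) =
    node (x i) T1 T2 ,
    dnode nc xv (inj₁ (i , refl)) (DMST-≈UP D1 (≈UP-sym (branch≈UP cXF A (x i) false xv)))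
                                  (DMST-≈UP D2 (≈UP-sym (branch≈UP cXF A (x i) true xv))) ,
    size-eq
    where
      nc : ¬ Conflict (cXF ∣ A)
      nc = proj₁ (unassigned-x-branchable A i aok ua)
      xv : x i ∈Var U (cXF ∣ A)
      xv = proj₂ (unassigned-x-branchable A i aok ua)
      size-eq : suc (suc (size T1 + size T2)) ≡ weight A g
      size-eq = begin
        suc (suc (size T1 + size T2))                                   ≡⟨ cong suc (+-suc (size T1) (size T2)) ⟨
        suc (size T1) + suc (size T2)                                   ≡⟨ cong₂ _+_ eq1 eq2 ⟩
        weight (lit (x i) false ∷ A) g + weight (lit (x i) true ∷ A) g ≡⟨ weight-split A i g g g (λ _ _ → refl) (λ _ _ → refl) ⟨
        weight A g ∎
        where open ≡-Reasoning

  construct : ∀ ks A → Admissible A → AssignedOutside ks A →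
              (g : Vec Bool n → Tree) → (∀ X' → agrees X' A ≡ true → DMST Branch (F ∣ (assignX x X' ++ A)) (g X')) → Built A g
  construct [] A aok h g gD = build-assigned A g aok (λ i → h i (λ ())) gD
  construct (i ∷ ks) A aok h g gD with memLit (lit (x i) true) A in e1 | memLit (lit (x i) false) A in e2
  ... | true | _ = construct ks A aok (assignedOutside-∷ ks A i true h e1) g gD
  ... | false | true = construct ks A aok (assignedOutside-∷ ks A i false h e2) g gD
  ... | false | false = build-x A i g aok ua (branch false) (branch true)
    where
      ua : Unassigned A i
      ua true = e1
      ua false = e2
      branch : ∀ c → Built (lit (x i) c ∷ A) g
      branch c = construct ks (lit (x i) c ∷ A) (admissible-∷ A (x i) c aok (inj₁ (i , refl)) e1 e2) (assignedOutside-extend ks A i c h) g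
                   (λ X' agree → let (agreeA , ej) = agrees-∷-x⁻ X' A i c agree in
                                 subst (λ G → DMST Branch G (g X')) (sym (restrict-F-x X' A i c ej)) (gD X' agreeA))

  weight-[] : ∀ g → weight [] g ≡ 2 ^ n + sumVec (λ X' → size (g X'))
  weight-[] g = begin
    sumVec (λ X' → if agrees X' [] then suc (size (g X')) else 0) ≡⟨ sum-map-cong (allVec n) _ _ (λ X' → cong (λ b → if b then _ else 0) (agrees-[] X')) ⟩
    sum (map (λ X' → suc (size (g X'))) (allVec n))             ≡⟨ sum-map-suc (allVec n) (λ X' → size (g X')) ⟩
    length (allVec n) + sumVec (λ X' → size (g X'))               ≡⟨ cong (_+ sumVec (λ X' → size (g X'))) (length-allVec n) ⟩
    2 ^ n + sumVec (λ X' → size (g X')) ∎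
    where open ≡-Reasoning

  restrict-assignX-++-[] : ∀ X' → F ∣ (assignX x X' ++ []) ≡ F ∣ assignX x X'
  restrict-assignX-++-[] X' = cong (F ∣_) (++-identityʳ (assignX x X'))

  admissible-[] : Admissible []
  admissible-[] = (λ q ()) , (λ m ())

  lower-bound : ∀ T → DMST Branch cXF T →
                Σ (Vec Bool n → Tree) λ g → (∀ X' → DMST Branch (F ∣ assignX x X') (g X')) ×
                                            (2 ^ n + sumVec (λ X' → size (g X')) ≤ suc (size T))
  lower-bound T d with simulate T [] admissible-[] (subst (λ G → DMST Branch G T) (sym (restrict-[] cXF)) d)
  ... | g , gD , bound = g , (λ X' → subst (λ G → DMST Branch G (g X')) (restrict-assignX-++-[] X') (gD X' (agrees-[] X'))) ,
                         subst (_≤ suc (size T)) (weight-[] g) bound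

  upper-bound : ∀ g → (∀ X' → DMST Branch (F ∣ assignX x X') (g X')) →
                Σ Tree λ T → DMST Branch cXF T × (suc (size T) ≡ 2 ^ n + sumVec (λ X' → size (g X')))
  upper-bound g gD with construct (L.allFin n) [] admissible-[] (λ i i∉ → ⊥-elim (i∉ (∈-allFin i))) g
                         (λ X' _ → subst (λ G → DMST Branch G (g X')) (sym (restrict-assignX-++-[] X')) (gD X'))
  ... | T , D , eq = T , subst (λ G → DMST Branch G T) (restrict-[] cXF) D , trans eq (weight-[] g)

  minSize-cXF : (s : Vec Bool n → ℕ) → (∀ X' → MinSize Branch (F ∣ assignX x X') (fin (s X'))) →
                MinSize Branch cXF (fin (2 ^ n ∸ 1 + sumVec s))
  minSize-cXF s min with upper-bound (λ X' → proj₁ (proj₁ (min X'))) (λ X' → proj₁ (proj₂ (proj₁ (min X'))))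
  ... | T , D , eq = (T , D , suc-injective (trans eq (trans (cong (2 ^ n +_) sum-optimal) (sym 2^n-split)))) , minimal
    where
      2^n-split : suc (2 ^ n ∸ 1 + sumVec s) ≡ 2 ^ n + sumVec s
      2^n-split = suc-[m∸1]+n (sumVec s) (m^n>0 2 n)
      sum-optimal : sumVec (λ X' → size (proj₁ (proj₁ (min X')))) ≡ sumVec s
      sum-optimal = sum-map-cong (allVec n) _ _ (λ X' → proj₂ (proj₂ (proj₁ (min X'))))
      minimal : ∀ T' → DMST Branch cXF T' → 2 ^ n ∸ 1 + sumVec s ≤ size T'
      minimal T' d' with lower-bound T' d'
      ... | g , gD , bound = s≤s⁻¹ (subst (_≤ suc (size T')) (sym 2^n-split)
                               (≤-trans (+-monoʳ-≤ (2 ^ n) (sum-map-mono (allVec n) s _ (λ X' → proj₂ (min X') (g X') (gD X')))) bound))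

  noDMST-cXF : ∀ X' → MinSize Branch (F ∣ assignX x X') ∞ → MinSize Branch cXF ∞
  noDMST-cXF X' noTree (T , d) = let (g , gD , _) = lower-bound T d in noTree (g X' , gD X')

  minSize-cXF-sum∞ : (sv : Vec Bool n → ℕ∞) → (∀ X' → MinSize Branch (F ∣ assignX x X') (sv X')) →
                     MinSize Branch cXF (fin (2 ^ n ∸ 1) +∞ sum∞ (map sv (allVec n)))
  minSize-cXF-sum∞ sv min with sum∞ (map sv (allVec n)) in sum≡
  ... | ∞ = let (X' , sv≡∞) = sum∞-∞⁻ sv (allVec n) sum≡ in noDMST-cXF X' (subst (MinSize Branch _) sv≡∞ (min X'))
  ... | fin S with sum∞-fin⁻ sv (allVec n) S sum≡
  ... | finite , refl = minSize-cXF (λ X' → ℕ∞-toℕ (sv X'))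
                          (λ X' → subst (MinSize Branch _) (finite X' (∈-allVec n X')) (min X'))

corollary3 :
  (n : ℕ) (x : Fin n → ℕ) (ys zs : List ℕ) (F : Formula) →
  -- X = {x_1,…,x_n} has n distinct elements
  Injective _≡_ _≡_ x →
  -- X, Y, Z pairwise disjoint
  (∀ i → x i ∉ ys) → (∀ i → x i ∉ zs) → (∀ w → w ∈ ys → w ∉ zs) →
  -- F is a formula over X ∪ Y ∪ Z
  (∀ w → w ∈Var F → InXYZ x ys zs w) →
  -- for every truth assignment to X ∪ Y, unit propagation in F
  -- determines the values of all variables of Z
  (∀ (τ : ℕ → Bool) →
    let G = F ∣ assignOn τ (listX x ++ ys) in
    Conflict G ⊎ (∀ z → z ∈ zs → z ∈ map var (trail G))) →
  -- a, b, v_1,…,v_n are new (pairwise distinct, not in X ∪ Y ∪ Z)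
  (v : Fin n → ℕ) (a b : ℕ) →
  Injective _≡_ _≡_ v → a ≢ b → (∀ i → v i ≢ a) → (∀ i → v i ≢ b) →
  ¬ InXYZ x ys zs a → ¬ InXYZ x ys zs b → (∀ i → ¬ InXYZ x ys zs (v i)) →
  -- the values s(F|X') (branching restricted to X ∪ Y)
  (sv : Vec Bool n → ℕ∞) →
  (∀ X' → MinSize (InXY x ys) (F ∣ assignX x X') (sv X')) →
  -- s(c_X(F)) = 2^n - 1 + Σ_{X'} s(F|X')
  MinSize (InXY x ys) (cX n x v a b F)
    (fin (2 ^ n ∸ 1) +∞ sum∞ (map sv (allVec n)))
corollary3 n x ys zs F x-injective x∉ys _ _ F-over-XYZ _ v a b v-injective a≢b v≢a v≢b a-fresh b-fresh v-fresh =
  Construction.minSize-cXF-sum∞ n x ys zs F x-injective x∉ys F-over-XYZ v a b v-injective a≢b v≢a v≢b a-fresh b-fresh v-fresh
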